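{- Let $r/s>1$ be a rational number with regular continued fraction expansion $[a_1,\ldots,a_{2m}]$ and negative continued fraction expansion $\llbracket c_1,\ldots,c_k\rrbracket$ (so that $k=a_2+a_4+\cdots+a_{2m}$), and let $\left[\frac rs\right]_q=\frac{\mathcal R(q)}{\mathcal S(q)}$. Then $$\mathcal R(q)=K_k(c_1,\ldots,c_k)_q=q^{a_2+a_4+\cdots+a_{2m}-1}K^+_{2m}(a_1,\ldots,a_{2m})_q,$$ $$\mathcal S(q)=K_{k-1}(c_2,\ldots,c_k)_q=q^{a_2+a_4+\cdots+a_{2m}-1}K^+_{2m-1}(a_2,\ldots,a_{2m})_q.$$
   Context: $q$ is a formal variable, $[a]_q=1+q+\cdots+q^{a-1}$, $[a]_{q^{ -1}}=1+q^{ -1}+\cdots+q^{ -(a-1)}$. Every rational $r/s>1$ ($r,s$ coprime positive) has a unique expansion $r/s=a_1+\cfrac{1}{a_2+\cfrac{1}{\ddots+\cfrac{1}{a_{2m}}}}$ with an even number of integers $a_i\ge1$, and a unique expansion $r/s=c_1-\cfrac{1}{c_2-\cfrac{1}{\ddots-\cfrac{1}{c_k}}}$ with integers $c_i\ge 2$. The $q$-rational is $\left[\frac rs\right]_q=[c_1]_q-\cfrac{q^{c_1-1}}{[c_2]_q-\cfrac{q^{c_2-1}}{\ddots-\cfrac{q^{c_{k-1}-1}}{[c_k]_q}}}$, written as $\frac{\mathcal R}{\mathcal S}$ with $\mathcal R,\mathcal S\in\mathbb Z[q]$ coprime, $\mathcal R(1)=r$, $\mathcal S(1)=s$. $q$-continuants: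 $K_k(c_1,\ldots,c_k)_q$ is the determinant of the $k\times k$ tridiagonal matrix with diagonal entries $[c_1]_q,\ldots,[c_k]_q$, entry $q^{c_i-1}$ in position $(i,i+1)$ for $1\le i\le k-1$, entry $1$ in position $(i+1,i)$, and zeros elsewhere (with $K_0():=1$). $K^+_{2m}(a_1,\ldots,a_{2m})_q$ is the determinant of the $2m\times 2m$ tridiagonal matrix with diagonal entries $[a_1]_q,[a_2]_{q^{ -1}},[a_3]_q,[a_4]_{q^{ -1}},\ldots,[a_{2m}]_{q^{ -1}}$, entry $q^{a_i}$ ($i$ odd) or $q^{ -a_i}$ ($i$ even) in position $(i,i+1)$, entry $-1$ in position $(i+1,i)$, zeros elsewhere. $K^+_{2m-1}(a_2,\ldots,a_{2m})_q$ is the determinant of the $(2m-1)\times(2m-1)$ tridiagonal matrix with diagonal entries $[a_2]_{q^{ -1}},[a_3]_q,[a_4]_{q^{ -1}},\ldots,[a_{2m}]_{q^{ -1}}$, entry to the right of the diagonal entry for $a_i$ equal to $q^{ -a_i}$ if $i$ is even and $q^{a_i}$ if $i$ is odd, subdiagonal entries $-1$, zeros elsewhere. -}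

module Defs where

open import Data.Nat as ℕ using (ℕ; zero; suc; _∸_)
open import Data.Integer as ℤ using (ℤ; +_)
open import Data.List using (List; []; _∷_; length; lookup; replicate; _++_; map; foldr)
open import Data.Fin using (Fin; toℕ; punchIn) renaming (zero to fzero; suc to fsuc)
open import Data.Bool using (Bool; true; false; if_then_else_)
open import Data.Product using (_×_; _,_; ∃)
open import Relation.Nullary using (yes; no)
open import Relation.Binary.PropositionalEquality using (_≡_)

-- Polynomials in ℤ[q] as coefficient lists (constant term first),
-- compared coefficientwise (trailing zeros irrelevant).

Poly : Set
Poly = List ℤ

coeff : Poly → ℕ → ℤ
coeff []      _       = + 0
coeff (x ∷ p) zero    = x
coeff (x ∷ p) (suc n) = coeff p n

infix 4 _≈P_
_≈P_ : Poly → Poly → Set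
P ≈P Q = ∀ n → coeff P n ≡ coeff Q n

infixl 6 _+P_
_+P_ : Poly → Poly → Poly
[]      +P q       = q
(x ∷ p) +P []      = x ∷ p
(x ∷ p) +P (y ∷ q) = (x ℤ.+ y) ∷ (p +P q)

negP : Poly → Poly
negP = map (λ x → ℤ.- x)

scaleP : ℤ → Poly → Poly
scaleP c = map (c ℤ.*_)

infixl 7 _*P_
_*P_ : Poly → Poly → Poly
[]      *P q = []
(x ∷ p) *P q = scaleP x q +P (+ 0 ∷ (p *P q))

0P 1P : Poly
0P = []
1P = + 1 ∷ []

qpow : ℕ → Poly
qpow n = replicate n (+ 0) ++ (+ 1 ∷ [])

qint : ℕ → Poly
qint zero    = 0P
qint (suc a) = qint a +P qpow a

eval1 : Poly → ℤ
eval1 = foldr ℤ._+_ (+ 0)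

infix 4 _∣P_
_∣P_ : Poly → Poly → Set
D ∣P P = ∃ λ E → D *P E ≈P P

CoprimeP : Poly → Poly → Set
CoprimeP R S = ∀ D → D ∣P R → D ∣P S → D ∣P 1P

-- Laurent polynomials ℤ[q,q⁻¹]: a pair (P , n) stands for q^(-n)·P.

Laurent : Set
Laurent = Poly × ℕ

infix 4 _≈L_
_≈L_ : Laurent → Laurent → Set
(P , n) ≈L (Q , m) = qpow m *P P ≈P qpow n *P Q

infixl 6 _+L_
_+L_ : Laurent → Laurent → Laurent
(P , n) +L (Q , m) = (qpow m *P P +P qpow n *P Q , n ℕ.+ m)

infixl 7 _*L_
_*L_ : Laurent → Laurent → Laurent
(P , n) *L (Q , m) = (P *P Q , n ℕ.+ m)

negL : Laurent → Laurent
negL (P , n) = (negP P , n)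

toL : Poly → Laurent
toL P = (P , 0)

0L 1L : Laurent
0L = toL 0P
1L = toL 1P

qpowL qinvPowL : ℕ → Laurent
qpowL n = toL (qpow n)
qinvPowL n = (1P , n)

qintInv : ℕ → Laurent
qintInv zero    = 0L
qintInv (suc a) = qintInv a +L qinvPowL a

module Det {A : Set} (_+_ _*_ : A → A → A) (-_ : A → A) (0# 1# : A) where

  sign : ℕ → A → A
  sign zero    x = x
  sign (suc k) x = - sign k x

  sumFin : ∀ n → (Fin n → A) → A
  sumFin zero    f = 0#
  sumFin (suc n) f = f fzero + sumFin n (λ j → f (fsuc j))

  det : ∀ n → (Fin n → Fin n → A) → A
  det zero    M = 1#
  det (suc n) M = sumFin (suc n) λ j →
    sign (toℕ j) (M fzero j * det n (λ i k → M (fsuc i) (punchIn j k)))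

  tridiag : ∀ n → (d u l : Fin n → A) → Fin n → Fin n → A
  tridiag n d u l i j with toℕ j ℕ.≟ toℕ i | toℕ j ℕ.≟ suc (toℕ i) | toℕ i ℕ.≟ suc (toℕ j)
  ... | yes _ | _     | _     = d i
  ... | no _  | yes _ | _     = u i
  ... | no _  | no _  | yes _ = l j
  ... | no _  | no _  | no _  = 0#

module DP = Det _+P_ _*P_ negP 0P 1P
module DL = Det _+L_ _*L_ negL 0L 1L

K : List ℕ → Poly
K cs = DP.det (length cs)
  (DP.tridiag (length cs)
    (λ i → qint (lookup cs i))
    (λ i → qpow (lookup cs i ∸ 1))
    (λ _ → 1P))

isEven : ℕ → Bool
isEven zero          = true
isEven (suc zero)    = false
isEven (suc (suc n)) = isEven n

-- Kplus off as : the K⁺ determinant for the entries as, where the entry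
-- at (0-based) position p carries the original (1-based) index p + off + 1.
-- Kplus 0 (a_1,...,a_{2m})   = K⁺_{2m}(a_1,...,a_{2m})_q
-- Kplus 1 (a_2,...,a_{2m})   = K⁺_{2m-1}(a_2,...,a_{2m})_q
Kplus : ℕ → List ℕ → Laurent
Kplus off as = DL.det (length as)
  (DL.tridiag (length as)
    (λ p → if isEven (toℕ p ℕ.+ off) then toL (qint (lookup as p)) else qintInv (lookup as p))
    (λ p → if isEven (toℕ p ℕ.+ off) then qpowL (lookup as p) else qinvPowL (lookup as p))
    (λ _ → negL 1L))

evenSum : List ℕ → ℕ
evenSum (x ∷ y ∷ t) = y ℕ.+ evenSum t
evenSum _           = 0

drop1 : {A : Set} → List A → List A
drop1 []      = []
drop1 (_ ∷ t) = t

-- Continued fraction values as unreduced fractions (numerator , denominator),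
-- computed by the usual fraction arithmetic; [] stands for ∞ = 1/0, so that
-- a single term [x] evaluates to x/1.

regCF : List ℕ → ℕ × ℕ
regCF []      = (1 , 0)
regCF (a ∷ t) with regCF t
... | (p , q) = (a ℕ.* p ℕ.+ q , p)

negCF : List ℕ → ℤ × ℤ
negCF []      = (+ 1 , + 0)
negCF (c ∷ t) with negCF t
... | (p , q) = (+ c ℤ.* p ℤ.- q , p)

qCF : List ℕ → Poly × Poly
qCF []      = (1P , 0P)
qCF (c ∷ t) with qCF t
... | (N , D) = (qint c *P N +P negP (qpow (c ∸ 1) *P D) , N)

-- Numerator and denominator of the q-deformed negative continued fraction satisfy the
-- three-term continuant recurrence, which is also the first-row expansion of the tridiagonal
-- determinants K(c₁,…,c_k) and K(c₂,…,c_k).  They are coprime: a Bézout relation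
-- N X + D Y = q^e holds and N has constant term 1.  So a coprime representative (R, S) of the
-- same fraction is (N, D) times a unit of ℤ[q], and the unit is 1 because R(1) = r > 0.
-- The negative expansion of r/s is unique, hence it is the image
-- ⟦a₁+1, 2^(a₂−1), a₃+2, 2^(a₄−1), …⟧ of the regular one; pushing this substitution through the
-- recurrence block by block, using [b]_{q⁻¹} q^b = q [b]_q, turns the q-continuant into
-- q^(a₂+a₄+⋯−1) times the alternating determinant K⁺.

module Submission where

open import Defs
import Data.Nat
open import Data.Nat as ℕ using (ℕ; zero; suc; _∸_; z≤n; s≤s; _≤_; _<_; _*_)
import Data.Nat.Properties as ℕP
open import Data.Nat.DivMod using (_/_; +-distrib-/-∣ʳ; m<n⇒m/n≡0; m*n/n≡m)
open import Data.Nat.Divisibility using (divides)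
open import Data.Nat.Coprimality using (Coprime)
open import Data.Nat.Tactic.RingSolver using () renaming (solve-∀ to solveℕ)
open import Data.Integer as ℤ using (ℤ; +_; -[1+_])
import Data.Integer.Properties as ℤP
open import Data.Integer.Tactic.RingSolver using () renaming (solve-∀ to solveℤ)
open import Data.Fin using (Fin; toℕ; punchIn) renaming (zero to fzero; suc to fsuc)
open import Data.Bool using (Bool; true; false; if_then_else_; not)
open import Data.List using (List; []; _∷_; length; lookup; replicate; _++_)
open import Data.List.Relation.Unary.All using (All; []; _∷_)
import Data.List.Relation.Unary.All.Properties as All
open import Data.Product using (_×_; _,_; proj₁; proj₂; Σ; ∃)
open import Data.Sum using (_⊎_; inj₁; inj₂)
open import Data.Maybe using (Maybe; nothing; just)
open import Data.Empty using (⊥; ⊥-elim)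
open import Relation.Nullary using (yes; no; ¬_; Dec)
open import Relation.Binary.PropositionalEquality
  using (_≡_; _≢_; refl; sym; trans; cong; cong₂; subst; subst₂; module ≡-Reasoning)
open import Algebra.Bundles using (CommutativeRing)
open import Level using (0ℓ)
open import Function using (_∘_)
open import Tactic.RingSolver.Core.AlmostCommutativeRing using (AlmostCommutativeRing; fromCommutativeRing)
open import Tactic.RingSolver using (solve-∀)
import Relation.Binary.Reasoning.Setoid as SetoidReasoning

-- The ring ℤ[q]

-- _≈P_ unfolds to a Π-type from which Agda cannot recover P and Q;
-- the record keeps them inferable.
infix 4 _≋_
record _≋_ (P Q : Poly) : Set where
  constructor ⟨_⟩
  field coeff≡ : P ≈P Q
open _≋_ public

≋-refl : ∀ {P} → P ≋ P
≋-refl = ⟨ (λ _ → refl) ⟩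

≋-sym : ∀ {P Q} → P ≋ Q → Q ≋ P
≋-sym ⟨ h ⟩ = ⟨ (λ n → sym (h n)) ⟩

≋-trans : ∀ {P Q R} → P ≋ Q → Q ≋ R → P ≋ R
≋-trans ⟨ h ⟩ ⟨ g ⟩ = ⟨ (λ n → trans (h n) (g n)) ⟩

shift : Poly → Poly
shift P = + 0 ∷ P

coeff-+P : ∀ P Q n → coeff (P +P Q) n ≡ coeff P n ℤ.+ coeff Q n
coeff-+P []      Q       n       = sym (ℤP.+-identityˡ _)
coeff-+P (x ∷ p) []      n       = sym (ℤP.+-identityʳ _)
coeff-+P (x ∷ p) (y ∷ q) zero    = refl
coeff-+P (x ∷ p) (y ∷ q) (suc n) = coeff-+P p q n

coeff-negP : ∀ P n → coeff (negP P) n ≡ ℤ.- coeff P n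
coeff-negP []      n       = refl
coeff-negP (x ∷ p) zero    = refl
coeff-negP (x ∷ p) (suc n) = coeff-negP p n

coeff-scaleP : ∀ c P n → coeff (scaleP c P) n ≡ c ℤ.* coeff P n
coeff-scaleP c []      n       = sym (ℤP.*-zeroʳ c)
coeff-scaleP c (x ∷ p) zero    = refl
coeff-scaleP c (x ∷ p) (suc n) = coeff-scaleP c p n

+P-cong : ∀ {P P′ Q Q′} → P ≋ P′ → Q ≋ Q′ → P +P Q ≋ P′ +P Q′
+P-cong {P} {P′} {Q} {Q′} ⟨ h ⟩ ⟨ g ⟩ =
  ⟨ (λ n → trans (coeff-+P P Q n) (trans (cong₂ ℤ._+_ (h n) (g n)) (sym (coeff-+P P′ Q′ n)))) ⟩

negP-cong : ∀ {P P′} → P ≋ P′ → negP P ≋ negP P′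
negP-cong {P} {P′} ⟨ h ⟩ =
  ⟨ (λ n → trans (coeff-negP P n) (trans (cong ℤ.-_ (h n)) (sym (coeff-negP P′ n)))) ⟩

shift-cong : ∀ {P P′} → P ≋ P′ → shift P ≋ shift P′
shift-cong ⟨ h ⟩ = ⟨ (λ { zero → refl ; (suc n) → h n }) ⟩

shift-cancel : ∀ {P P′} → shift P ≋ shift P′ → P ≋ P′
shift-cancel ⟨ h ⟩ = ⟨ (λ n → h (suc n)) ⟩

*P-annihilˡ : ∀ P Q → P ≈P [] → P *P Q ≈P []
*P-annihilˡ []      Q h n = refl
*P-annihilˡ (x ∷ p) Q h n = begin
  coeff (scaleP x Q +P shift (p *P Q)) n          ≡⟨ coeff-+P (scaleP x Q) (shift (p *P Q)) n ⟩
  coeff (scaleP x Q) n ℤ.+ coeff (shift (p *P Q)) n ≡⟨ cong₂ ℤ._+_ (coeff-scaleP x Q n) (tail-vanishes n) ⟩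
  x ℤ.* coeff Q n ℤ.+ + 0                         ≡⟨ cong (λ z → z ℤ.* coeff Q n ℤ.+ + 0) (h zero) ⟩
  + 0 ℤ.* coeff Q n ℤ.+ + 0                       ≡⟨ cong (ℤ._+ + 0) (ℤP.*-zeroˡ (coeff Q n)) ⟩
  + 0                                             ∎
  where
  open ≡-Reasoning
  tail-vanishes : ∀ n → coeff (shift (p *P Q)) n ≡ + 0
  tail-vanishes zero    = refl
  tail-vanishes (suc n) = *P-annihilˡ p Q (λ k → h (suc k)) n

*P-congʳ : ∀ {P P′} Q → P ≋ P′ → P *P Q ≋ P′ *P Q
*P-congʳ {[]}    {P′}     Q ⟨ h ⟩ = ⟨ (λ n → sym (*P-annihilˡ P′ Q (λ k → sym (h k)) n)) ⟩
*P-congʳ {x ∷ p} {[]}     Q ⟨ h ⟩ = ⟨ *P-annihilˡ (x ∷ p) Q h ⟩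
*P-congʳ {x ∷ p} {x′ ∷ p′} Q ⟨ h ⟩ =
  +P-cong (subst (λ y → scaleP x Q ≋ scaleP y Q) (h zero) ≋-refl)
          (shift-cong (*P-congʳ {p} {p′} Q ⟨ (λ n → h (suc n)) ⟩))

scaleP-+P : ∀ c P Q → scaleP c (P +P Q) ≋ scaleP c P +P scaleP c Q
scaleP-+P c P Q = ⟨ (λ n → begin
  coeff (scaleP c (P +P Q)) n                   ≡⟨ coeff-scaleP c (P +P Q) n ⟩
  c ℤ.* coeff (P +P Q) n                        ≡⟨ cong (c ℤ.*_) (coeff-+P P Q n) ⟩
  c ℤ.* (coeff P n ℤ.+ coeff Q n)               ≡⟨ ℤP.*-distribˡ-+ c (coeff P n) (coeff Q n) ⟩
  c ℤ.* coeff P n ℤ.+ c ℤ.* coeff Q n           ≡⟨ cong₂ ℤ._+_ (coeff-scaleP c P n) (coeff-scaleP c Q n) ⟨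
  coeff (scaleP c P) n ℤ.+ coeff (scaleP c Q) n ≡⟨ coeff-+P (scaleP c P) (scaleP c Q) n ⟨
  coeff (scaleP c P +P scaleP c Q) n            ∎) ⟩
  where open ≡-Reasoning

+P-comm : ∀ P Q → P +P Q ≋ Q +P P
+P-comm P Q = ⟨ (λ n → trans (coeff-+P P Q n)
  (trans (ℤP.+-comm (coeff P n) (coeff Q n)) (sym (coeff-+P Q P n)))) ⟩

+P-assoc : ∀ P Q R → (P +P Q) +P R ≋ P +P (Q +P R)
+P-assoc P Q R = ⟨ (λ n → begin
  coeff ((P +P Q) +P R) n                   ≡⟨ coeff-+P (P +P Q) R n ⟩
  coeff (P +P Q) n ℤ.+ coeff R n            ≡⟨ cong (ℤ._+ coeff R n) (coeff-+P P Q n) ⟩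
  coeff P n ℤ.+ coeff Q n ℤ.+ coeff R n     ≡⟨ ℤP.+-assoc (coeff P n) (coeff Q n) (coeff R n) ⟩
  coeff P n ℤ.+ (coeff Q n ℤ.+ coeff R n)   ≡⟨ cong (λ z → coeff P n ℤ.+ z) (coeff-+P Q R n) ⟨
  coeff P n ℤ.+ coeff (Q +P R) n            ≡⟨ coeff-+P P (Q +P R) n ⟨
  coeff (P +P (Q +P R)) n                   ∎) ⟩
  where open ≡-Reasoning

+P-identityˡ : ∀ P → [] +P P ≋ P
+P-identityˡ P = ≋-refl

+P-identityʳ : ∀ P → P +P [] ≋ P
+P-identityʳ []      = ≋-refl
+P-identityʳ (x ∷ P) = ≋-refl

negP-inverseˡ : ∀ P → negP P +P P ≋ []
negP-inverseˡ P = ⟨ (λ n → trans (coeff-+P (negP P) P n)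
  (trans (cong (ℤ._+ coeff P n) (coeff-negP P n)) (ℤP.+-inverseˡ (coeff P n)))) ⟩

negP-inverseʳ : ∀ P → P +P negP P ≋ []
negP-inverseʳ P = ≋-trans (+P-comm P (negP P)) (negP-inverseˡ P)

+P-interchange : ∀ A B C D → (A +P B) +P (C +P D) ≋ (A +P C) +P (B +P D)
+P-interchange A B C D = ⟨ (λ n → begin
  coeff ((A +P B) +P (C +P D)) n
    ≡⟨ coeff-+P (A +P B) (C +P D) n ⟩
  coeff (A +P B) n ℤ.+ coeff (C +P D) n
    ≡⟨ cong₂ ℤ._+_ (coeff-+P A B n) (coeff-+P C D n) ⟩
  (coeff A n ℤ.+ coeff B n) ℤ.+ (coeff C n ℤ.+ coeff D n)
    ≡⟨ interchange (coeff A n) (coeff B n) (coeff C n) (coeff D n) ⟩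
  (coeff A n ℤ.+ coeff C n) ℤ.+ (coeff B n ℤ.+ coeff D n)
    ≡⟨ cong₂ ℤ._+_ (coeff-+P A C n) (coeff-+P B D n) ⟨
  coeff (A +P C) n ℤ.+ coeff (B +P D) n
    ≡⟨ coeff-+P (A +P C) (B +P D) n ⟨
  coeff ((A +P C) +P (B +P D)) n ∎) ⟩
  where
  open ≡-Reasoning
  interchange : ∀ a b c d → (a ℤ.+ b) ℤ.+ (c ℤ.+ d) ≡ (a ℤ.+ c) ℤ.+ (b ℤ.+ d)
  interchange = solveℤ

shift-+P : ∀ P Q → shift (P +P Q) ≋ shift P +P shift Q
shift-+P P Q = ⟨ (λ { zero → refl ; (suc n) → refl }) ⟩

scaleP-shift : ∀ c P → scaleP c (shift P) ≋ shift (scaleP c P)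
scaleP-shift c P = ⟨ (λ { zero → ℤP.*-zeroʳ c ; (suc n) → refl }) ⟩

scaleP-scaleP : ∀ c d P → scaleP c (scaleP d P) ≋ scaleP (c ℤ.* d) P
scaleP-scaleP c d P = ⟨ (λ n → trans (coeff-scaleP c (scaleP d P) n)
  (trans (cong (c ℤ.*_) (coeff-scaleP d P n))
  (trans (sym (ℤP.*-assoc c d (coeff P n))) (sym (coeff-scaleP (c ℤ.* d) P n))))) ⟩

scaleP-zero : ∀ P → scaleP (+ 0) P ≋ []
scaleP-zero P = ⟨ (λ n → trans (coeff-scaleP (+ 0) P n) (ℤP.*-zeroˡ (coeff P n))) ⟩

scaleP-one : ∀ P → scaleP (+ 1) P ≋ P
scaleP-one P = ⟨ (λ n → trans (coeff-scaleP (+ 1) P n) (ℤP.*-identityˡ (coeff P n))) ⟩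

scaleP-distribʳ : ∀ c d P → scaleP (c ℤ.+ d) P ≋ scaleP c P +P scaleP d P
scaleP-distribʳ c d P = ⟨ (λ n → trans (coeff-scaleP (c ℤ.+ d) P n)
  (trans (ℤP.*-distribʳ-+ (coeff P n) c d)
  (sym (trans (coeff-+P (scaleP c P) (scaleP d P) n)
              (cong₂ ℤ._+_ (coeff-scaleP c P n) (coeff-scaleP d P n)))))) ⟩

*P-zeroʳ : ∀ P → P *P [] ≋ []
*P-zeroʳ []      = ≋-refl
*P-zeroʳ (x ∷ p) = ≋-trans (+P-cong {scaleP x []} ≋-refl (shift-cong (*P-zeroʳ p)))
                           ⟨ (λ { zero → refl ; (suc n) → refl }) ⟩

*P-distribʳ : ∀ Q P P′ → (P +P P′) *P Q ≋ P *P Q +P P′ *P Q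
*P-distribʳ Q []      P′       = ≋-refl
*P-distribʳ Q (x ∷ p) []       = ≋-sym (+P-identityʳ _)
*P-distribʳ Q (x ∷ p) (y ∷ p′) =
  ≋-trans (+P-cong (scaleP-distribʳ x y Q)
                   (≋-trans (shift-cong (*P-distribʳ Q p p′)) (shift-+P (p *P Q) (p′ *P Q))))
          (+P-interchange (scaleP x Q) (scaleP y Q) (shift (p *P Q)) (shift (p′ *P Q)))

shift-*P : ∀ A Q → shift A *P Q ≋ shift (A *P Q)
shift-*P A Q = +P-cong (scaleP-zero Q) ≋-refl

scaleP-*P : ∀ c P Q → scaleP c (P *P Q) ≋ scaleP c P *P Q
scaleP-*P c []      Q = ≋-refl
scaleP-*P c (y ∷ q) Q =
  ≋-trans (scaleP-+P c (scaleP y Q) (shift (q *P Q)))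
          (+P-cong (scaleP-scaleP c y Q)
                   (≋-trans (scaleP-shift c (q *P Q)) (shift-cong (scaleP-*P c q Q))))

*P-assoc : ∀ P Q R → (P *P Q) *P R ≋ P *P (Q *P R)
*P-assoc []      Q R = ≋-refl
*P-assoc (x ∷ p) Q R =
  ≋-trans (*P-distribʳ R (scaleP x Q) (shift (p *P Q)))
          (+P-cong (≋-sym (scaleP-*P x Q R))
                   (≋-trans (shift-*P (p *P Q) R) (shift-cong (*P-assoc p Q R))))

*P-cons : ∀ P y Q → P *P (y ∷ Q) ≋ scaleP y P +P shift (P *P Q)
*P-cons P y Q = ⟨ coeffs P ⟩
  where
  open ≡-Reasoning
  coeffs : ∀ P → P *P (y ∷ Q) ≈P scaleP y P +P shift (P *P Q)
  coeffs []      zero    = refl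
  coeffs []      (suc n) = refl
  coeffs (x ∷ p) zero    = swap x y
    where
    swap : ∀ x y → x ℤ.* y ℤ.+ + 0 ≡ y ℤ.* x ℤ.+ + 0
    swap = solveℤ
  coeffs (x ∷ p) (suc n) = begin
    coeff (scaleP x Q +P p *P (y ∷ Q)) n
      ≡⟨ coeff-+P (scaleP x Q) (p *P (y ∷ Q)) n ⟩
    a ℤ.+ coeff (p *P (y ∷ Q)) n
      ≡⟨ cong (λ z → a ℤ.+ z) (trans (coeffs p n) (coeff-+P (scaleP y p) (shift (p *P Q)) n)) ⟩
    a ℤ.+ (b ℤ.+ c)
      ≡⟨ exchange a b c ⟩
    b ℤ.+ (a ℤ.+ c)
      ≡⟨ cong (λ z → b ℤ.+ z) (coeff-+P (scaleP x Q) (shift (p *P Q)) n) ⟨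
    b ℤ.+ coeff (scaleP x Q +P shift (p *P Q)) n
      ≡⟨ coeff-+P (scaleP y p) (scaleP x Q +P shift (p *P Q)) n ⟨
    coeff (scaleP y p +P (scaleP x Q +P shift (p *P Q))) n ∎
    where
    a = coeff (scaleP x Q) n
    b = coeff (scaleP y p) n
    c = coeff (shift (p *P Q)) n
    exchange : ∀ a b c → a ℤ.+ (b ℤ.+ c) ≡ b ℤ.+ (a ℤ.+ c)
    exchange = solveℤ

*P-comm : ∀ P Q → P *P Q ≋ Q *P P
*P-comm []      Q = ≋-sym (*P-zeroʳ Q)
*P-comm (x ∷ p) Q = ≋-sym (≋-trans (*P-cons Q x p) (+P-cong ≋-refl (shift-cong (*P-comm Q p))))

*P-identityˡ : ∀ P → 1P *P P ≋ P
*P-identityˡ P = ≋-trans (+P-cong (scaleP-one P) ⟨ (λ { zero → refl ; (suc n) → refl }) ⟩)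
                         (+P-identityʳ P)

*P-identityʳ : ∀ P → P *P 1P ≋ P
*P-identityʳ P = ≋-trans (*P-comm P 1P) (*P-identityˡ P)

*P-distribˡ : ∀ P Q Q′ → P *P (Q +P Q′) ≋ P *P Q +P P *P Q′
*P-distribˡ P Q Q′ = ≋-trans (*P-comm P _)
  (≋-trans (*P-distribʳ P Q Q′) (+P-cong (*P-comm Q P) (*P-comm Q′ P)))

*P-cong : ∀ {P P′ Q Q′} → P ≋ P′ → Q ≋ Q′ → P *P Q ≋ P′ *P Q′
*P-cong {P} {P′} {Q} {Q′} h g =
  ≋-trans (*P-congʳ Q h) (≋-trans (*P-comm P′ Q) (≋-trans (*P-congʳ P′ g) (*P-comm Q′ P′)))

polyCommutativeRing : CommutativeRing 0ℓ 0ℓ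
polyCommutativeRing = record
  { Carrier = Poly ; _≈_ = _≋_ ; _+_ = _+P_ ; _*_ = _*P_ ; -_ = negP ; 0# = 0P ; 1# = 1P
  ; isCommutativeRing = record
    { isRing = record
      { +-isAbelianGroup = record
        { isGroup = record
          { isMonoid = record
            { isSemigroup = record
              { isMagma = record
                { isEquivalence = record { refl = ≋-refl ; sym = ≋-sym ; trans = ≋-trans }
                ; ∙-cong = +P-cong }
              ; assoc = +P-assoc }
            ; identity = +P-identityˡ , +P-identityʳ }
          ; inverse = negP-inverseˡ , negP-inverseʳ
          ; ⁻¹-cong = negP-cong }
        ; comm = +P-comm }
      ; *-cong = *P-cong
      ; *-assoc = *P-assoc
      ; *-identity = *P-identityˡ , *P-identityʳ
      ; distrib = *P-distribˡ , *P-distribʳ }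
    ; *-comm = *P-comm } }

≋-zero? : (P : Poly) → Maybe ([] ≋ P)
≋-zero? [] = just ≋-refl
≋-zero? (c ∷ p) with c ℤ.≟ + 0 | ≋-zero? p
... | yes c≡0 | just ⟨ h ⟩ = just ⟨ (λ { zero → sym c≡0 ; (suc n) → h n }) ⟩
... | _       | _          = nothing

polyACR : AlmostCommutativeRing 0ℓ 0ℓ
polyACR = fromCommutativeRing polyCommutativeRing ≋-zero?

-- Laurent polynomials

qpow-+ : ∀ a b → qpow (a ℕ.+ b) ≋ qpow a *P qpow b
qpow-+ zero    b = ≋-sym (*P-identityˡ (qpow b))
qpow-+ (suc a) b = ≋-trans (shift-cong (qpow-+ a b)) (≋-sym (shift-*P (qpow a) (qpow b)))

qpow-cancelˡ : ∀ k {A B} → qpow k *P A ≋ qpow k *P B → A ≋ B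
qpow-cancelˡ zero    {A} {B} h = ≋-trans (≋-sym (*P-identityˡ A)) (≋-trans h (*P-identityˡ B))
qpow-cancelˡ (suc k) {A} {B} h = qpow-cancelˡ k (shift-cancel
  (≋-trans (≋-sym (shift-*P (qpow k) A)) (≋-trans h (shift-*P (qpow k) B))))

infix 4 _≃_
record _≃_ (X Y : Laurent) : Set where
  constructor ⟪_⟫
  field cross : qpow (proj₂ Y) *P proj₁ X ≋ qpow (proj₂ X) *P proj₁ Y
open _≃_ public

≃⇒≈L : ∀ {X Y} → X ≃ Y → X ≈L Y
≃⇒≈L {P , n} {Q , m} ⟪ h ⟫ = coeff≡ h

module ≋-Reasoning = SetoidReasoning (CommutativeRing.setoid polyCommutativeRing)

module _ where
  open ≋-Reasoning

  ≃-refl : ∀ {X} → X ≃ X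
  ≃-refl = ⟪ ≋-refl ⟫

  ≃-sym : ∀ {X Y} → X ≃ Y → Y ≃ X
  ≃-sym ⟪ h ⟫ = ⟪ ≋-sym h ⟫

  ≃-trans : ∀ {X Y Z} → X ≃ Y → Y ≃ Z → X ≃ Z
  ≃-trans {P , n} {R , m} {S , k} ⟪ h ⟫ ⟪ g ⟫ = ⟪ qpow-cancelˡ m (begin
    qpow m *P (qpow k *P P) ≈⟨ swap (qpow m) (qpow k) P ⟩
    qpow k *P (qpow m *P P) ≈⟨ *P-cong (≋-refl {qpow k}) h ⟩
    qpow k *P (qpow n *P R) ≈⟨ swap (qpow k) (qpow n) R ⟩
    qpow n *P (qpow k *P R) ≈⟨ *P-cong (≋-refl {qpow n}) g ⟩
    qpow n *P (qpow m *P S) ≈⟨ swap (qpow n) (qpow m) S ⟩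
    qpow m *P (qpow n *P S) ∎) ⟫
    where
    swap : ∀ a b x → a *P (b *P x) ≋ b *P (a *P x)
    swap = solve-∀ polyACR

  +L-cong : ∀ {X X′ Y Y′} → X ≃ X′ → Y ≃ Y′ → X +L Y ≃ X′ +L Y′
  +L-cong {P , n} {P′ , n′} {R , m} {R′ , m′} ⟪ h ⟫ ⟪ g ⟫ = ⟪ (begin
    qpow (n′ ℕ.+ m′) *P (qpow m *P P +P qpow n *P R)
      ≈⟨ *P-cong (qpow-+ n′ m′) ≋-refl ⟩
    (qpow n′ *P qpow m′) *P (qpow m *P P +P qpow n *P R)
      ≈⟨ expand (qpow n′) (qpow m′) (qpow m) (qpow n) P R ⟩
    qpow m′ *P qpow m *P (qpow n′ *P P) +P qpow n′ *P qpow n *P (qpow m′ *P R)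
      ≈⟨ +P-cong (*P-cong (≋-refl {qpow m′ *P qpow m}) h) (*P-cong (≋-refl {qpow n′ *P qpow n}) g) ⟩
    qpow m′ *P qpow m *P (qpow n *P P′) +P qpow n′ *P qpow n *P (qpow m *P R′)
      ≈⟨ collect (qpow n) (qpow m) (qpow m′) (qpow n′) P′ R′ ⟩
    (qpow n *P qpow m) *P (qpow m′ *P P′ +P qpow n′ *P R′)
      ≈⟨ *P-cong (qpow-+ n m) ≋-refl ⟨
    qpow (n ℕ.+ m) *P (qpow m′ *P P′ +P qpow n′ *P R′) ∎) ⟫
    where
    expand : ∀ a b c d x y → (a *P b) *P (c *P x +P d *P y) ≋ b *P c *P (a *P x) +P a *P d *P (b *P y)
    expand = solve-∀ polyACR
    collect : ∀ a b c d x y → c *P b *P (a *P x) +P d *P a *P (b *P y) ≋ (a *P b) *P (c *P x +P d *P y)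
    collect = solve-∀ polyACR

  *L-cong : ∀ {X X′ Y Y′} → X ≃ X′ → Y ≃ Y′ → X *L Y ≃ X′ *L Y′
  *L-cong {P , n} {P′ , n′} {R , m} {R′ , m′} ⟪ h ⟫ ⟪ g ⟫ = ⟪ (begin
    qpow (n′ ℕ.+ m′) *P (P *P R)        ≈⟨ *P-cong (qpow-+ n′ m′) ≋-refl ⟩
    (qpow n′ *P qpow m′) *P (P *P R)    ≈⟨ interchange (qpow n′) (qpow m′) P R ⟩
    (qpow n′ *P P) *P (qpow m′ *P R)    ≈⟨ *P-cong h g ⟩
    (qpow n *P P′) *P (qpow m *P R′)    ≈⟨ interchange (qpow n) (qpow m) P′ R′ ⟨
    (qpow n *P qpow m) *P (P′ *P R′)    ≈⟨ *P-cong (qpow-+ n m) ≋-refl ⟨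
    qpow (n ℕ.+ m) *P (P′ *P R′)        ∎) ⟫
    where
    interchange : ∀ a b x y → (a *P b) *P (x *P y) ≋ (a *P x) *P (b *P y)
    interchange = solve-∀ polyACR

  negL-cong : ∀ {X X′} → X ≃ X′ → negL X ≃ negL X′
  negL-cong {P , n} {P′ , n′} ⟪ h ⟫ = ⟪ (begin
    qpow n′ *P negP P    ≈⟨ *-neg (qpow n′) P ⟩
    negP (qpow n′ *P P)  ≈⟨ negP-cong h ⟩
    negP (qpow n *P P′)  ≈⟨ *-neg (qpow n) P′ ⟨
    qpow n *P negP P′    ∎) ⟫
    where
    *-neg : ∀ a x → a *P negP x ≋ negP (a *P x)
    *-neg = solve-∀ polyACR

  +L-assoc : ∀ X Y Z → (X +L Y) +L Z ≃ X +L (Y +L Z)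
  +L-assoc (P , n) (R , m) (S , k) = ⟪ (begin
    qpow (n ℕ.+ (m ℕ.+ k)) *P (qpow k *P (qpow m *P P +P qpow n *P R) +P qpow (n ℕ.+ m) *P S)
      ≈⟨ *P-cong (≋-trans (qpow-+ n (m ℕ.+ k)) (*P-cong (≋-refl {qpow n}) (qpow-+ m k)))
                 (+P-cong ≋-refl (*P-cong (qpow-+ n m) ≋-refl)) ⟩
    (qpow n *P (qpow m *P qpow k)) *P (qpow k *P (qpow m *P P +P qpow n *P R) +P (qpow n *P qpow m) *P S)
      ≈⟨ reassociate (qpow n) (qpow m) (qpow k) P R S ⟩
    ((qpow n *P qpow m) *P qpow k) *P ((qpow m *P qpow k) *P P +P qpow n *P (qpow k *P R +P qpow m *P S))
      ≈⟨ *P-cong (≋-trans (qpow-+ (n ℕ.+ m) k) (*P-cong (qpow-+ n m) ≋-refl))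
                 (+P-cong (*P-cong (qpow-+ m k) ≋-refl) ≋-refl) ⟨
    qpow ((n ℕ.+ m) ℕ.+ k) *P (qpow (m ℕ.+ k) *P P +P qpow n *P (qpow k *P R +P qpow m *P S)) ∎) ⟫
    where
    reassociate : ∀ a b c x y z →
      (a *P (b *P c)) *P (c *P (b *P x +P a *P y) +P (a *P b) *P z)
        ≋ ((a *P b) *P c) *P ((b *P c) *P x +P a *P (c *P y +P b *P z))
    reassociate = solve-∀ polyACR

  +L-comm : ∀ X Y → X +L Y ≃ Y +L X
  +L-comm (P , n) (R , m) = ⟪ (begin
    qpow (m ℕ.+ n) *P (qpow m *P P +P qpow n *P R)        ≈⟨ *P-cong (qpow-+ m n) ≋-refl ⟩
    (qpow m *P qpow n) *P (qpow m *P P +P qpow n *P R)    ≈⟨ commute (qpow m) (qpow n) P R ⟩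
    (qpow n *P qpow m) *P (qpow n *P R +P qpow m *P P)    ≈⟨ *P-cong (qpow-+ n m) ≋-refl ⟨
    qpow (n ℕ.+ m) *P (qpow n *P R +P qpow m *P P)        ∎) ⟫
    where
    commute : ∀ a b x y → (a *P b) *P (a *P x +P b *P y) ≋ (b *P a) *P (b *P y +P a *P x)
    commute = solve-∀ polyACR

  +L-identityˡ : ∀ X → 0L +L X ≃ X
  +L-identityˡ (P , n) = ⟪ simplify (qpow n) P ⟫
    where
    simplify : ∀ a x → a *P (a *P [] +P 1P *P x) ≋ a *P x
    simplify = solve-∀ polyACR

  +L-identityʳ : ∀ X → X +L 0L ≃ X
  +L-identityʳ (P , n) = ⟪ (begin
    qpow n *P (1P *P P +P qpow n *P [])  ≈⟨ simplify (qpow n) P ⟩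
    qpow n *P P                          ≡⟨ cong (λ z → qpow z *P P) (ℕP.+-identityʳ n) ⟨
    qpow (n ℕ.+ 0) *P P                  ∎) ⟫
    where
    simplify : ∀ a x → a *P (1P *P x +P a *P []) ≋ a *P x
    simplify = solve-∀ polyACR

  negL-inverseˡ : ∀ X → negL X +L X ≃ 0L
  negL-inverseˡ (P , n) = ⟪ (begin
    1P *P (qpow n *P negP P +P qpow n *P P)  ≈⟨ *P-identityˡ _ ⟩
    qpow n *P negP P +P qpow n *P P          ≈⟨ *P-distribˡ (qpow n) (negP P) P ⟨
    qpow n *P (negP P +P P)                  ≈⟨ *P-cong (≋-refl {qpow n}) (negP-inverseˡ P) ⟩
    qpow n *P []                             ≈⟨ *P-zeroʳ (qpow n) ⟩
    []                                       ≈⟨ *P-zeroʳ (qpow (n ℕ.+ n)) ⟨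
    qpow (n ℕ.+ n) *P []                     ∎) ⟫

  negL-inverseʳ : ∀ X → X +L negL X ≃ 0L
  negL-inverseʳ X = ≃-trans (+L-comm X (negL X)) (negL-inverseˡ X)

  *L-assoc : ∀ X Y Z → (X *L Y) *L Z ≃ X *L (Y *L Z)
  *L-assoc (P , n) (R , m) (S , k) = ⟪ (begin
    qpow (n ℕ.+ (m ℕ.+ k)) *P ((P *P R) *P S)
      ≈⟨ *P-cong (≋-trans (qpow-+ n (m ℕ.+ k)) (*P-cong (≋-refl {qpow n}) (qpow-+ m k))) ≋-refl ⟩
    (qpow n *P (qpow m *P qpow k)) *P ((P *P R) *P S)
      ≈⟨ reassociate (qpow n) (qpow m) (qpow k) P R S ⟩
    ((qpow n *P qpow m) *P qpow k) *P (P *P (R *P S))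
      ≈⟨ *P-cong (≋-trans (qpow-+ (n ℕ.+ m) k) (*P-cong (qpow-+ n m) ≋-refl)) ≋-refl ⟨
    qpow ((n ℕ.+ m) ℕ.+ k) *P (P *P (R *P S)) ∎) ⟫
    where
    reassociate : ∀ a b c x y z → (a *P (b *P c)) *P ((x *P y) *P z) ≋ ((a *P b) *P c) *P (x *P (y *P z))
    reassociate = solve-∀ polyACR

  *L-comm : ∀ X Y → X *L Y ≃ Y *L X
  *L-comm (P , n) (R , m) = ⟪ (begin
    qpow (m ℕ.+ n) *P (P *P R)        ≈⟨ *P-cong (qpow-+ m n) ≋-refl ⟩
    (qpow m *P qpow n) *P (P *P R)    ≈⟨ commute (qpow m) (qpow n) P R ⟩
    (qpow n *P qpow m) *P (R *P P)    ≈⟨ *P-cong (qpow-+ n m) ≋-refl ⟨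
    qpow (n ℕ.+ m) *P (R *P P)        ∎) ⟫
    where
    commute : ∀ a b x y → (a *P b) *P (x *P y) ≋ (b *P a) *P (y *P x)
    commute = solve-∀ polyACR

  *L-identityˡ : ∀ X → 1L *L X ≃ X
  *L-identityˡ (P , n) = ⟪ simplify (qpow n) P ⟫
    where
    simplify : ∀ a x → a *P (1P *P x) ≋ a *P x
    simplify = solve-∀ polyACR

  *L-identityʳ : ∀ X → X *L 1L ≃ X
  *L-identityʳ X = ≃-trans (*L-comm X 1L) (*L-identityˡ X)

  *L-distribʳ : ∀ Z X Y → (X +L Y) *L Z ≃ X *L Z +L Y *L Z
  *L-distribʳ (S , k) (P , n) (R , m) = ⟪ (begin
    qpow ((n ℕ.+ k) ℕ.+ (m ℕ.+ k)) *P ((qpow m *P P +P qpow n *P R) *P S)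
      ≈⟨ *P-cong (≋-trans (qpow-+ (n ℕ.+ k) (m ℕ.+ k)) (*P-cong (qpow-+ n k) (qpow-+ m k))) ≋-refl ⟩
    ((qpow n *P qpow k) *P (qpow m *P qpow k)) *P ((qpow m *P P +P qpow n *P R) *P S)
      ≈⟨ distribute (qpow n) (qpow m) (qpow k) P R S ⟩
    ((qpow n *P qpow m) *P qpow k) *P ((qpow m *P qpow k) *P (P *P S) +P (qpow n *P qpow k) *P (R *P S))
      ≈⟨ *P-cong (≋-trans (qpow-+ (n ℕ.+ m) k) (*P-cong (qpow-+ n m) ≋-refl))
                 (+P-cong (*P-cong (qpow-+ m k) ≋-refl) (*P-cong (qpow-+ n k) ≋-refl)) ⟨
    qpow ((n ℕ.+ m) ℕ.+ k) *P (qpow (m ℕ.+ k) *P (P *P S) +P qpow (n ℕ.+ k) *P (R *P S)) ∎) ⟫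
    where
    distribute : ∀ a b c x y z → ((a *P c) *P (b *P c)) *P ((b *P x +P a *P y) *P z)
       ≋ ((a *P b) *P c) *P ((b *P c) *P (x *P z) +P (a *P c) *P (y *P z))
    distribute = solve-∀ polyACR

  *L-distribˡ : ∀ Z X Y → Z *L (X +L Y) ≃ Z *L X +L Z *L Y
  *L-distribˡ Z X Y = ≃-trans (*L-comm Z (X +L Y))
    (≃-trans (*L-distribʳ Z X Y) (+L-cong (*L-comm X Z) (*L-comm Y Z)))

laurentCommutativeRing : CommutativeRing 0ℓ 0ℓ
laurentCommutativeRing = record
  { Carrier = Laurent ; _≈_ = _≃_ ; _+_ = _+L_ ; _*_ = _*L_ ; -_ = negL ; 0# = 0L ; 1# = 1L
  ; isCommutativeRing = record
    { isRing = record
      { +-isAbelianGroup = record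
        { isGroup = record
          { isMonoid = record
            { isSemigroup = record
              { isMagma = record
                { isEquivalence = record { refl = ≃-refl ; sym = ≃-sym ; trans = ≃-trans }
                ; ∙-cong = +L-cong }
              ; assoc = +L-assoc }
            ; identity = +L-identityˡ , +L-identityʳ }
          ; inverse = negL-inverseˡ , negL-inverseʳ
          ; ⁻¹-cong = negL-cong }
        ; comm = +L-comm }
      ; *-cong = *L-cong
      ; *-assoc = *L-assoc
      ; *-identity = *L-identityˡ , *L-identityʳ
      ; distrib = *L-distribˡ , *L-distribʳ }
    ; *-comm = *L-comm } }

≃-zero? : (X : Laurent) → Maybe (0L ≃ X)
≃-zero? (P , n) with ≋-zero? P
... | just h  = just ⟪ ≋-trans (*P-zeroʳ (qpow n)) (≋-trans h (≋-sym (*P-identityˡ P))) ⟫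
... | nothing = nothing

laurentACR : AlmostCommutativeRing 0ℓ 0ℓ
laurentACR = fromCommutativeRing laurentCommutativeRing ≃-zero?

module ≃-Reasoning = SetoidReasoning (CommutativeRing.setoid laurentCommutativeRing)

-- Tridiagonal determinants

module TridiagonalDeterminant (R : CommutativeRing 0ℓ 0ℓ) where

  open CommutativeRing R renaming (_*_ to _·_; refl to ≈-refl; sym to ≈-sym; trans to ≈-trans)
  open Det _+_ _·_ -_ 0# 1#
  open import Algebra.Properties.AbelianGroup +-abelianGroup using (ε⁻¹≈ε)

  continuant : ∀ n → (d u l : Fin n → Carrier) → Carrier
  continuant zero          d u l = 1#
  continuant (suc zero)    d u l = d fzero
  continuant (suc (suc n)) d u l =
    d fzero · continuant (suc n) (d ∘ fsuc) (u ∘ fsuc) (l ∘ fsuc)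
    + - (u fzero · (l fzero · continuant n (d ∘ fsuc ∘ fsuc) (u ∘ fsuc ∘ fsuc) (l ∘ fsuc ∘ fsuc)))

  continuant-cong : ∀ n {d d′ u u′ l l′ : Fin n → Carrier} →
    (∀ i → d i ≡ d′ i) → (∀ i → u i ≡ u′ i) → (∀ i → l i ≡ l′ i) →
    continuant n d u l ≡ continuant n d′ u′ l′
  continuant-cong zero          hd hu hl = refl
  continuant-cong (suc zero)    hd hu hl = hd fzero
  continuant-cong (suc (suc n)) hd hu hl =
    cong₂ _+_ (cong₂ _·_ (hd fzero) (continuant-cong (suc n) (hd ∘ fsuc) (hu ∘ fsuc) (hl ∘ fsuc)))
      (cong -_ (cong₂ _·_ (hu fzero) (cong₂ _·_ (hl fzero)
        (continuant-cong n (hd ∘ fsuc ∘ fsuc) (hu ∘ fsuc ∘ fsuc) (hl ∘ fsuc ∘ fsuc)))))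

  ≡⇒≈ : ∀ {x y} → x ≡ y → x ≈ y
  ≡⇒≈ refl = ≈-refl

  sign-zero : ∀ k {x} → x ≈ 0# → sign k x ≈ 0#
  sign-zero zero    e = e
  sign-zero (suc k) e = ≈-trans (-‿cong (sign-zero k e)) ε⁻¹≈ε

  sumFin-zero : ∀ n {f : Fin n → Carrier} → (∀ j → f j ≈ 0#) → sumFin n f ≈ 0#
  sumFin-zero zero    h = ≈-refl
  sumFin-zero (suc n) h = ≈-trans (+-cong (h fzero) (sumFin-zero n (h ∘ fsuc))) (+-identityˡ 0#)

  det-zeroColumn : ∀ n (M : Fin (suc n) → Fin (suc n) → Carrier) →
    (∀ i → M i fzero ≡ 0#) → det (suc n) M ≈ 0#

  laterCofactors-zero : ∀ n (M : Fin (suc n) → Fin (suc n) → Carrier) → (∀ i → M (fsuc i) fzero ≡ 0#) →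
    sumFin n (λ j → sign (suc (toℕ j)) (M fzero (fsuc j) · det n (λ i k → M (fsuc i) (punchIn (fsuc j) k)))) ≈ 0#

  det-zeroColumn n M h =
    ≈-trans (+-cong (≈-trans (*-cong (≡⇒≈ (h fzero)) ≈-refl) (zeroˡ _)) (laterCofactors-zero n M (h ∘ fsuc)))
            (+-identityˡ 0#)

  laterCofactors-zero zero    M h = ≈-refl
  laterCofactors-zero (suc n) M h = sumFin-zero (suc n) λ j → sign-zero (suc (toℕ j))
    (≈-trans (*-cong (≈-refl {M fzero (fsuc j)}) (det-zeroColumn n (λ i k → M (fsuc i) (punchIn (fsuc j) k)) h)) (zeroʳ _))

  module _ {n} (d u l : Fin n → Carrier) where

    tridiag-diag : ∀ i j → toℕ j ≡ toℕ i → tridiag n d u l i j ≡ d i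
    tridiag-diag i j e with toℕ j ℕ.≟ toℕ i | toℕ j ℕ.≟ suc (toℕ i) | toℕ i ℕ.≟ suc (toℕ j)
    ... | yes _ | _ | _ = refl
    ... | no ¬e | _ | _ = ⊥-elim (¬e e)

    tridiag-super : ∀ i j → toℕ j ≡ suc (toℕ i) → tridiag n d u l i j ≡ u i
    tridiag-super i j e with toℕ j ℕ.≟ toℕ i | toℕ j ℕ.≟ suc (toℕ i) | toℕ i ℕ.≟ suc (toℕ j)
    ... | yes e′ | _      | _ = ⊥-elim (ℕP.1+n≢n (trans (sym e) e′))
    ... | no _   | yes _  | _ = refl
    ... | no _   | no ¬e  | _ = ⊥-elim (¬e e)

    tridiag-sub : ∀ i j → toℕ i ≡ suc (toℕ j) → tridiag n d u l i j ≡ l j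
    tridiag-sub i j e with toℕ j ℕ.≟ toℕ i | toℕ j ℕ.≟ suc (toℕ i) | toℕ i ℕ.≟ suc (toℕ j)
    ... | yes e′ | _      | _     = ⊥-elim (ℕP.1+n≢n (trans (sym e) (sym e′)))
    ... | no _   | yes e′ | _     = ⊥-elim (ℕP.m≢1+n+m (toℕ j) {1} (trans e′ (cong suc e)))
    ... | no _   | no _   | yes _ = refl
    ... | no _   | no _   | no ¬e = ⊥-elim (¬e e)

    tridiag-off : ∀ i j → ¬ toℕ j ≡ toℕ i → ¬ toℕ j ≡ suc (toℕ i) → ¬ toℕ i ≡ suc (toℕ j) →
      tridiag n d u l i j ≡ 0#
    tridiag-off i j ¬d ¬u ¬l with toℕ j ℕ.≟ toℕ i | toℕ j ℕ.≟ suc (toℕ i) | toℕ i ℕ.≟ suc (toℕ j)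
    ... | yes e | _     | _     = ⊥-elim (¬d e)
    ... | no _  | yes e | _     = ⊥-elim (¬u e)
    ... | no _  | no _  | yes e = ⊥-elim (¬l e)
    ... | no _  | no _  | no _  = refl

  tridiag-tail : ∀ n (d u l : Fin (suc n) → Carrier) i j →
    tridiag (suc n) d u l (fsuc i) (fsuc j) ≡ tridiag n (d ∘ fsuc) (u ∘ fsuc) (l ∘ fsuc) i j
  tridiag-tail n d u l i j = byCases (toℕ j ℕ.≟ toℕ i) (toℕ j ℕ.≟ suc (toℕ i)) (toℕ i ℕ.≟ suc (toℕ j))
    where
    d′ = d ∘ fsuc
    u′ = u ∘ fsuc
    l′ = l ∘ fsuc
    byCases : Dec (toℕ j ≡ toℕ i) → Dec (toℕ j ≡ suc (toℕ i)) → Dec (toℕ i ≡ suc (toℕ j)) →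
      tridiag (suc n) d u l (fsuc i) (fsuc j) ≡ tridiag n d′ u′ l′ i j
    byCases (yes e) _ _ =
      trans (tridiag-diag d u l (fsuc i) (fsuc j) (cong suc e)) (sym (tridiag-diag d′ u′ l′ i j e))
    byCases (no _) (yes e) _ =
      trans (tridiag-super d u l (fsuc i) (fsuc j) (cong suc e)) (sym (tridiag-super d′ u′ l′ i j e))
    byCases (no _) (no _) (yes e) =
      trans (tridiag-sub d u l (fsuc i) (fsuc j) (cong suc e)) (sym (tridiag-sub d′ u′ l′ i j e))
    byCases (no ¬d) (no ¬u) (no ¬l) =
      trans (tridiag-off d u l (fsuc i) (fsuc j)
               (¬d ∘ ℕP.suc-injective) (¬u ∘ ℕP.suc-injective) (¬l ∘ ℕP.suc-injective))
            (sym (tridiag-off d′ u′ l′ i j ¬d ¬u ¬l))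

  IsTridiagonal : ∀ n → (d u l : Fin n → Carrier) → (Fin n → Fin n → Carrier) → Set
  IsTridiagonal n d u l M = ∀ i j → M i j ≡ tridiag n d u l i j

  IsTridiagonal-tail : ∀ n {d u l : Fin (suc n) → Carrier} {M} → IsTridiagonal (suc n) d u l M →
    IsTridiagonal n (d ∘ fsuc) (u ∘ fsuc) (l ∘ fsuc) (λ i j → M (fsuc i) (fsuc j))
  IsTridiagonal-tail n {d} {u} {l} t i j = trans (t (fsuc i) (fsuc j)) (tridiag-tail n d u l i j)

  -- Expansion along the first row, and of the second minor along its first column,
  -- gives the three-term recurrence defining the continuant.
  det-tridiagonal : ∀ n (d u l : Fin n → Carrier) M → IsTridiagonal n d u l M → det n M ≈ continuant n d u l
  det-tridiagonal zero          d u l M t = ≈-refl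
  det-tridiagonal (suc zero)    d u l M t =
    ≈-trans (+-identityʳ _) (≈-trans (*-identityʳ _) (≡⇒≈ (trans (t fzero fzero) (tridiag-diag d u l fzero fzero refl))))
  det-tridiagonal (suc (suc n)) d u l M t =
    +-cong (*-cong (entry fzero fzero (tridiag-diag d u l fzero fzero refl))
                   (det-tridiagonal (suc n) _ _ _ _ (IsTridiagonal-tail (suc n) t)))
           (≈-trans (+-cong (-‿cong (*-cong (entry fzero (fsuc fzero) (tridiag-super d u l fzero (fsuc fzero) refl))
                                          secondMinor))
                          (sumFin-zero n farTerms))
                  (+-identityʳ _))
    where
    entry : ∀ i j {x} → tridiag (suc (suc n)) d u l i j ≡ x → M i j ≈ x
    entry i j e = ≡⇒≈ (trans (t i j) e)
    secondMinor : det (suc n) (λ i k → M (fsuc i) (punchIn (fsuc fzero) k))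
                  ≈ l fzero · continuant n (d ∘ fsuc ∘ fsuc) (u ∘ fsuc ∘ fsuc) (l ∘ fsuc ∘ fsuc)
    secondMinor =
      ≈-trans (+-cong (*-cong (entry (fsuc fzero) fzero (tridiag-sub d u l (fsuc fzero) fzero refl))
                            (det-tridiagonal n _ _ _ _ (IsTridiagonal-tail n (IsTridiagonal-tail (suc n) t))))
                    (laterCofactors-zero n (λ i k → M (fsuc i) (punchIn (fsuc fzero) k)) λ i →
                       trans (t (fsuc (fsuc i)) fzero) (tridiag-off d u l (fsuc (fsuc i)) fzero (λ ()) (λ ()) (λ ()))))
            (+-identityʳ _)
    farTerms : ∀ (j : Fin n) → sign (suc (suc (toℕ j)))
                 (M fzero (fsuc (fsuc j)) · det (suc n) (λ i k → M (fsuc i) (punchIn (fsuc (fsuc j)) k))) ≈ 0#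
    farTerms j = sign-zero (suc (suc (toℕ j)))
      (≈-trans (*-cong (entry fzero (fsuc (fsuc j)) (tridiag-off d u l fzero (fsuc (fsuc j)) (λ ()) (λ ()) (λ ()))) ≈-refl)
             (zeroˡ _))

-- q-continuants

qNumer qDenom : List ℕ → Poly
qNumer cs = proj₁ (qCF cs)
qDenom cs = proj₂ (qCF cs)

module PolyTridiagonal = TridiagonalDeterminant polyCommutativeRing
module LaurentTridiagonal = TridiagonalDeterminant laurentCommutativeRing

qContinuant≋qNumer : ∀ cs →
  PolyTridiagonal.continuant (length cs) (λ i → qint (lookup cs i)) (λ i → qpow (lookup cs i ∸ 1)) (λ _ → 1P)
    ≋ qNumer cs
qContinuant≋qNumer []           = ≋-refl
qContinuant≋qNumer (c ∷ [])     = ≋-sym (≋-trans (+P-cong (*P-identityʳ (qint c)) (negP-cong (*P-zeroʳ (qpow (c ∸ 1)))))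
                                                 (+P-identityʳ (qint c)))
qContinuant≋qNumer (c ∷ c′ ∷ t) =
  +P-cong (*P-cong (≋-refl {qint c}) (qContinuant≋qNumer (c′ ∷ t)))
          (negP-cong (*P-cong (≋-refl {qpow (c ∸ 1)}) (≋-trans (*P-identityˡ _) (qContinuant≋qNumer t))))

K≋qNumer : ∀ cs → K cs ≋ qNumer cs
K≋qNumer cs = ≋-trans
  (PolyTridiagonal.det-tridiagonal (length cs) (λ i → qint (lookup cs i)) (λ i → qpow (lookup cs i ∸ 1)) (λ _ → 1P)
    _ (λ i j → refl))
  (qContinuant≋qNumer cs)

-- b records whether the first entry carries [a]_q and q^a (true) or [a]_{q⁻¹} and q^(-a) (false).
diagL superL : Bool → ℕ → Laurent
diagL  b a = if b then toL (qint a) else qintInv a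
superL b a = if b then qpowL a else qinvPowL a

K⁺ : Bool → List ℕ → Laurent
K⁺ b []           = 1L
K⁺ b (a ∷ [])     = diagL b a
K⁺ b (a ∷ a′ ∷ t) = diagL b a *L K⁺ (not b) (a′ ∷ t) +L negL (superL b a *L (negL 1L *L K⁺ b t))

K⁺-tail : Bool → List ℕ → Laurent
K⁺-tail b []      = 0L
K⁺-tail b (_ ∷ t) = K⁺ (not b) t

isEven-suc : ∀ n → isEven (suc n) ≡ not (isEven n)
isEven-suc zero          = refl
isEven-suc (suc zero)    = refl
isEven-suc (suc (suc n)) = isEven-suc n

laurentContinuant≡K⁺ : ∀ off as →
  LaurentTridiagonal.continuant (length as)
    (λ p → diagL (isEven (toℕ p ℕ.+ off)) (lookup as p)) (λ p → superL (isEven (toℕ p ℕ.+ off)) (lookup as p))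
    (λ _ → negL 1L)
  ≡ K⁺ (isEven off) as
laurentContinuant≡K⁺ off []           = refl
laurentContinuant≡K⁺ off (a ∷ [])     = refl
laurentContinuant≡K⁺ off (a ∷ a′ ∷ t) =
  cong₂ (λ x y → diagL (isEven off) a *L x +L negL (superL (isEven off) a *L (negL 1L *L y)))
    (trans (LaurentTridiagonal.continuant-cong (suc (length t))
              (λ p → cong (λ b → diagL b (lookup (a′ ∷ t) p)) (shiftParity p))
              (λ p → cong (λ b → superL b (lookup (a′ ∷ t) p)) (shiftParity p))
              (λ _ → refl))
      (trans (laurentContinuant≡K⁺ (suc off) (a′ ∷ t)) (cong (λ b → K⁺ b (a′ ∷ t)) (isEven-suc off))))
    (laurentContinuant≡K⁺ off t)
  where
  shiftParity : ∀ (p : Fin (suc (length t))) → isEven (suc (toℕ p) ℕ.+ off) ≡ isEven (toℕ p ℕ.+ suc off)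
  shiftParity p = cong isEven (sym (ℕP.+-suc (toℕ p) off))

Kplus≃K⁺ : ∀ off as → Kplus off as ≃ K⁺ (isEven off) as
Kplus≃K⁺ off as = subst (Kplus off as ≃_) (laurentContinuant≡K⁺ off as)
  (LaurentTridiagonal.det-tridiagonal (length as) _ _ _ _ (λ i j → refl))

q q⁻¹ : Laurent
q   = qpowL 1
q⁻¹ = qinvPowL 1

toL-cong : ∀ {P Q} → P ≋ Q → toL P ≃ toL Q
toL-cong h = ⟪ *P-cong (≋-refl {1P}) h ⟫

toL-+P : ∀ P Q → toL (P +P Q) ≃ toL P +L toL Q
toL-+P P Q = ⟪ distribute P Q ⟫
  where
  distribute : ∀ x y → 1P *P (x +P y) ≋ 1P *P (1P *P x +P 1P *P y)
  distribute = solve-∀ polyACR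

qpowL-+ : ∀ a b → qpowL (a ℕ.+ b) ≃ qpowL a *L qpowL b
qpowL-+ a b = toL-cong (qpow-+ a b)

qpowL-suc : ∀ n → qpowL (suc n) ≃ q *L qpowL n
qpowL-suc n = qpowL-+ 1 n

qintL-sucʳ : ∀ n → toL (qint (suc n)) ≃ toL (qint n) +L qpowL n
qintL-sucʳ n = toL-+P (qint n) (qpow n)

qintL-sucˡ : ∀ n → toL (qint (suc n)) ≃ 1L +L q *L toL (qint n)
qintL-sucˡ zero    = simplify (toL (qint 1)) q
  where
  simplify : ∀ x y → x ≃ x +L y *L 0L
  simplify = solve-∀ laurentACR
qintL-sucˡ (suc n) = begin
  toL (qint (suc (suc n)))                 ≈⟨ qintL-sucʳ (suc n) ⟩
  toL (qint (suc n)) +L qpowL (suc n)      ≈⟨ +L-cong (qintL-sucˡ n) (qpowL-suc n) ⟩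
  (1L +L q *L toL (qint n)) +L q *L qpowL n ≈⟨ factor q (toL (qint n)) (qpowL n) ⟩
  1L +L q *L (toL (qint n) +L qpowL n)      ≈⟨ +L-cong (≃-refl {1L}) (*L-cong (≃-refl {q}) (qintL-sucʳ n)) ⟨
  1L +L q *L toL (qint (suc n))             ∎
  where
  open ≃-Reasoning
  factor : ∀ q a b → (1L +L q *L a) +L q *L b ≃ 1L +L q *L (a +L b)
  factor = solve-∀ laurentACR

qinvPowL-inverse : ∀ b → qinvPowL b *L qpowL b ≃ 1L
qinvPowL-inverse b = ⟪ ≋-trans (*P-identityˡ _) (≋-trans (*P-identityˡ (qpow b))
  (≋-sym (≋-trans (*P-identityʳ (qpow (b ℕ.+ 0)))
                  (subst (λ z → qpow (b ℕ.+ 0) ≋ qpow z) (ℕP.+-identityʳ b) ≋-refl)))) ⟫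

qintInv-*qpowL : ∀ b → qintInv b *L qpowL b ≃ q *L toL (qint b)
qintInv-*qpowL zero    = simplify (qpowL 0) q
  where
  simplify : ∀ x y → 0L *L x ≃ y *L 0L
  simplify = solve-∀ laurentACR
qintInv-*qpowL (suc b) = begin
  (qintInv b +L qinvPowL b) *L qpowL (suc b)
    ≈⟨ *L-cong (≃-refl {qintInv b +L qinvPowL b}) (qpowL-suc b) ⟩
  (qintInv b +L qinvPowL b) *L (q *L qpowL b)
    ≈⟨ distribute (qintInv b) (qinvPowL b) q (qpowL b) ⟩
  q *L (qintInv b *L qpowL b) +L q *L (qinvPowL b *L qpowL b)
    ≈⟨ +L-cong (*L-cong (≃-refl {q}) (qintInv-*qpowL b)) (*L-cong (≃-refl {q}) (qinvPowL-inverse b)) ⟩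
  q *L (q *L toL (qint b)) +L q *L 1L
    ≈⟨ factor q (toL (qint b)) ⟩
  q *L (1L +L q *L toL (qint b))
    ≈⟨ *L-cong (≃-refl {q}) (qintL-sucˡ b) ⟨
  q *L toL (qint (suc b)) ∎
  where
  open ≃-Reasoning
  distribute : ∀ x y q z → (x +L y) *L (q *L z) ≃ q *L (x *L z) +L q *L (y *L z)
  distribute = solve-∀ laurentACR
  factor : ∀ q a → q *L (q *L a) +L q *L 1L ≃ q *L (1L +L q *L a)
  factor = solve-∀ laurentACR

not-involutive : ∀ b → not (not b) ≡ b
not-involutive true  = refl
not-involutive false = refl

K⁺-cons : ∀ b a t → K⁺ b (a ∷ t) ≃ diagL b a *L K⁺ (not b) t +L superL b a *L K⁺-tail (not b) t
K⁺-cons b a []       = simplify (diagL b a) (superL b a)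
  where
  simplify : ∀ x y → x ≃ x *L 1L +L y *L 0L
  simplify = solve-∀ laurentACR
K⁺-cons b a (a′ ∷ t) = begin
  diagL b a *L K⁺ (not b) (a′ ∷ t) +L negL (superL b a *L (negL 1L *L K⁺ b t))
    ≈⟨ simplify (diagL b a) (K⁺ (not b) (a′ ∷ t)) (superL b a) (K⁺ b t) ⟩
  diagL b a *L K⁺ (not b) (a′ ∷ t) +L superL b a *L K⁺ b t
    ≡⟨ cong (λ b′ → diagL b a *L K⁺ (not b) (a′ ∷ t) +L superL b a *L K⁺ b′ t) (not-involutive b) ⟨
  diagL b a *L K⁺ (not b) (a′ ∷ t) +L superL b a *L K⁺ (not (not b)) t ∎
  where
  open ≃-Reasoning
  simplify : ∀ d x u y → d *L x +L negL (u *L (negL 1L *L y)) ≃ d *L x +L u *L y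
  simplify = solve-∀ laurentACR

qNumer-cons : ∀ c t → toL (qNumer (c ∷ t)) ≃ toL (qint c) *L toL (qNumer t) +L negL (qpowL (c ∸ 1) *L toL (qDenom t))
qNumer-cons c t = toL-+P (qint c *P qNumer t) (negP (qpow (c ∸ 1) *P qDenom t))

-- From regular to negative expansions

twos : ℕ → List ℕ
twos n = replicate n 2

regToNegTail : List ℕ → List ℕ
regToNegTail (a ∷ b ∷ r) = suc (suc a) ∷ (twos (b ∸ 1) ++ regToNegTail r)
regToNegTail _           = []

regToNeg : List ℕ → List ℕ
regToNeg (a ∷ b ∷ r) = suc a ∷ (twos (b ∸ 1) ++ regToNegTail r)
regToNeg _           = []

data Paired : List ℕ → Set where
  []   : Paired []
  pair : ∀ {a b r} → Paired r → Paired (a ∷ suc b ∷ r)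

-- q^(a₂ + a₄ + ⋯ − 1), kept as a Laurent monomial to avoid truncated subtraction.
prefactor : List ℕ → Laurent
prefactor r = qpowL (evenSum r) *L q⁻¹

prefactor-cons : ∀ a b r → prefactor (a ∷ b ∷ r) ≃ qpowL b *L prefactor r
prefactor-cons a b r =
  ≃-trans (*L-cong (qpowL-+ b (evenSum r)) (≃-refl {q⁻¹})) (reassociate (qpowL b) (qpowL (evenSum r)) q⁻¹)
  where
  reassociate : ∀ x y z → (x *L y) *L z ≃ x *L (y *L z)
  reassociate = solve-∀ laurentACR

module _ (a b : ℕ) (r : List ℕ) where
  open ≃-Reasoning

  private
    ρ κ κ′ : Laurent
    ρ  = prefactor r
    κ  = ρ *L K⁺ true r
    κ′ = ρ *L K⁺-tail true r

  prefactor-K⁺-false : prefactor (a ∷ b ∷ r) *L K⁺ false (b ∷ r) ≃ q *L toL (qint b) *L κ +L κ′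
  prefactor-K⁺-false = begin
    prefactor (a ∷ b ∷ r) *L K⁺ false (b ∷ r)
      ≈⟨ *L-cong (prefactor-cons a b r) (K⁺-cons false b r) ⟩
    (qpowL b *L ρ) *L (qintInv b *L K⁺ true r +L qinvPowL b *L K⁺-tail true r)
      ≈⟨ regroup (qpowL b) ρ (qintInv b) (K⁺ true r) (qinvPowL b) (K⁺-tail true r) ⟩
    (qintInv b *L qpowL b) *L κ +L (qinvPowL b *L qpowL b) *L κ′
      ≈⟨ +L-cong (*L-cong (qintInv-*qpowL b) (≃-refl {κ})) (*L-cong (qinvPowL-inverse b) (≃-refl {κ′})) ⟩
    (q *L toL (qint b)) *L κ +L 1L *L κ′
      ≈⟨ simplify (q *L toL (qint b)) κ κ′ ⟩
    q *L toL (qint b) *L κ +L κ′ ∎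
    where
    regroup : ∀ x ρ y k z k′ → (x *L ρ) *L (y *L k +L z *L k′) ≃ (y *L x) *L (ρ *L k) +L (z *L x) *L (ρ *L k′)
    regroup = solve-∀ laurentACR
    simplify : ∀ x y z → x *L y +L 1L *L z ≃ x *L y +L z
    simplify = solve-∀ laurentACR

  prefactor-K⁺-true : prefactor (a ∷ b ∷ r) *L K⁺ true (a ∷ b ∷ r)
                      ≃ toL (qint a) *L (q *L toL (qint b) *L κ +L κ′) +L qpowL a *L qpowL b *L κ
  prefactor-K⁺-true = begin
    prefactor (a ∷ b ∷ r) *L K⁺ true (a ∷ b ∷ r)
      ≈⟨ *L-cong (≃-refl {prefactor (a ∷ b ∷ r)}) (K⁺-cons true a (b ∷ r)) ⟩
    prefactor (a ∷ b ∷ r) *L (toL (qint a) *L K⁺ false (b ∷ r) +L qpowL a *L K⁺ true r)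
      ≈⟨ distribute (prefactor (a ∷ b ∷ r)) (toL (qint a)) (K⁺ false (b ∷ r)) (qpowL a) (K⁺ true r) ⟩
    toL (qint a) *L (prefactor (a ∷ b ∷ r) *L K⁺ false (b ∷ r)) +L qpowL a *L (prefactor (a ∷ b ∷ r) *L K⁺ true r)
      ≈⟨ +L-cong (*L-cong (≃-refl {toL (qint a)}) prefactor-K⁺-false)
                 (*L-cong (≃-refl {qpowL a}) (*L-cong (prefactor-cons a b r) (≃-refl {K⁺ true r}))) ⟩
    toL (qint a) *L (q *L toL (qint b) *L κ +L κ′) +L qpowL a *L ((qpowL b *L ρ) *L K⁺ true r)
      ≈⟨ +L-cong (≃-refl {toL (qint a) *L (q *L toL (qint b) *L κ +L κ′)})
                 (reassociate (qpowL a) (qpowL b) ρ (K⁺ true r)) ⟩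
    toL (qint a) *L (q *L toL (qint b) *L κ +L κ′) +L qpowL a *L qpowL b *L κ ∎
    where
    distribute : ∀ ρ x k y k′ → ρ *L (x *L k +L y *L k′) ≃ x *L (ρ *L k) +L y *L (ρ *L k′)
    distribute = solve-∀ laurentACR
    reassociate : ∀ x y z w → x *L ((y *L z) *L w) ≃ x *L y *L (z *L w)
    reassociate = solve-∀ laurentACR

module _ (w₁ w₂ : Laurent) where
  open ≃-Reasoning

  affine-cong : ∀ {Z Z′} → Z ≃ Z′ → q *L Z *L w₁ +L w₂ ≃ q *L Z′ *L w₁ +L w₂
  affine-cong h = +L-cong (*L-cong (*L-cong (≃-refl {q}) h) (≃-refl {w₁})) (≃-refl {w₂})

  qCF-twos : ∀ n t → toL (qNumer t) ≃ q *L w₁ +L w₂ → toL (qDenom t) ≃ w₂ →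
    toL (qNumer (twos n ++ t)) ≃ q *L toL (qint (suc n)) *L w₁ +L w₂
    × toL (qDenom (twos n ++ t)) ≃ q *L toL (qint n) *L w₁ +L w₂
  qCF-twos zero    t hN hD = ≃-trans hN (unit q w₁ w₂) , ≃-trans hD (vanish q w₁ w₂)
    where
    unit : ∀ q w₁ w₂ → q *L w₁ +L w₂ ≃ q *L 1L *L w₁ +L w₂
    unit = solve-∀ laurentACR
    vanish : ∀ q w₁ w₂ → w₂ ≃ q *L 0L *L w₁ +L w₂
    vanish = solve-∀ laurentACR
  qCF-twos (suc n) t hN hD with qCF-twos n t hN hD
  ... | ihN , ihD = numerator , ihN
    where
    s : List ℕ
    s = twos n ++ t
    B P : Laurent
    B = toL (qint n)
    P = qpowL n
    -- [n+2] − [n+1] = q·([n+1] − [n]) = q^(n+1)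
    telescope : ∀ q B P w₁ w₂ → (1L +L q) *L (q *L (B +L P) *L w₁ +L w₂) +L negL (q *L (q *L B *L w₁ +L w₂))
                               ≃ q *L ((B +L P) +L q *L P) *L w₁ +L w₂
    telescope = solve-∀ laurentACR
    numerator : toL (qNumer (2 ∷ s)) ≃ q *L toL (qint (suc (suc n))) *L w₁ +L w₂
    numerator = begin
      toL (qNumer (2 ∷ s))
        ≈⟨ qNumer-cons 2 s ⟩
      toL (qint 2) *L toL (qNumer s) +L negL (q *L toL (qDenom s))
        ≈⟨ +L-cong (*L-cong (qintL-sucʳ 1) (≃-trans ihN (affine-cong (qintL-sucʳ n))))
                   (negL-cong (*L-cong (≃-refl {q}) ihD)) ⟩
      (1L +L q) *L (q *L (B +L P) *L w₁ +L w₂) +L negL (q *L (q *L B *L w₁ +L w₂))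
        ≈⟨ telescope q B P w₁ w₂ ⟩
      q *L ((B +L P) +L q *L P) *L w₁ +L w₂
        ≈⟨ affine-cong (≃-trans (qintL-sucʳ (suc n)) (+L-cong (qintL-sucʳ n) (qpowL-suc n))) ⟨
      q *L toL (qint (suc (suc n))) *L w₁ +L w₂ ∎

module RegToNegStep (a b′ : ℕ) (r : List ℕ)
  (hN : toL (qNumer (regToNegTail r)) ≃ q *L (prefactor r *L K⁺ true r) +L prefactor r *L K⁺-tail true r)
  (hD : toL (qDenom (regToNegTail r)) ≃ prefactor r *L K⁺-tail true r) where

  b : ℕ
  b = suc b′

  w₁ w₂ A Pa B P X Y : Laurent
  w₁ = prefactor r *L K⁺ true r
  w₂ = prefactor r *L K⁺-tail true r
  A  = toL (qint a)
  Pa = qpowL a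
  B  = toL (qint b′)
  P  = qpowL b′
  X  = q *L (B +L P) *L w₁ +L w₂
  Y  = q *L B *L w₁ +L w₂

  s : List ℕ
  s = twos b′ ++ regToNegTail r

  qNumer-block : toL (qNumer s) ≃ X
  qNumer-block = ≃-trans (proj₁ (qCF-twos w₁ w₂ b′ (regToNegTail r) hN hD)) (affine-cong w₁ w₂ (qintL-sucʳ b′))

  qDenom-block : toL (qDenom s) ≃ Y
  qDenom-block = proj₂ (qCF-twos w₁ w₂ b′ (regToNegTail r) hN hD)

  K⁺-false-block : prefactor (a ∷ b ∷ r) *L K⁺ false (b ∷ r) ≃ X
  K⁺-false-block = ≃-trans (prefactor-K⁺-false a b r) (affine-cong w₁ w₂ (qintL-sucʳ b′))

  K⁺-true-block : prefactor (a ∷ b ∷ r) *L K⁺ true (a ∷ b ∷ r) ≃ A *L X +L Pa *L (q *L P) *L w₁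
  K⁺-true-block = ≃-trans (prefactor-K⁺-true a b r)
    (+L-cong (*L-cong (≃-refl {A}) (affine-cong w₁ w₂ (qintL-sucʳ b′)))
             (*L-cong (*L-cong (≃-refl {Pa}) (qpowL-suc b′)) (≃-refl {w₁})))

qCF-regToNegTail : ∀ r → Paired r →
  toL (qNumer (regToNegTail r)) ≃ q *L (prefactor r *L K⁺ true r) +L prefactor r *L K⁺-tail true r
  × toL (qDenom (regToNegTail r)) ≃ prefactor r *L K⁺-tail true r
qCF-regToNegTail [] [] = ≃-trans (≃-sym (qinvPowL-inverse 1)) (expand q q⁻¹) , vanish q⁻¹
  where
  expand : ∀ q x → x *L q ≃ q *L ((1L *L x) *L 1L) +L (1L *L x) *L 0L
  expand = solve-∀ laurentACR
  vanish : ∀ x → 0L ≃ (1L *L x) *L 0L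
  vanish = solve-∀ laurentACR
qCF-regToNegTail (a ∷ suc b′ ∷ r) (pair p) with qCF-regToNegTail r p
... | hN , hD = numerator , ≃-trans qNumer-block (≃-sym K⁺-false-block)
  where
  open RegToNegStep a b′ r hN hD
  open ≃-Reasoning
  -- X − Y = q^(b′+1)·w₁ since [b′+1] − [b′] = q^b′; this is the whole step.
  collect : ∀ q A Pa B P w₁ w₂ →
    (1L +L q *L (A +L Pa)) *L (q *L (B +L P) *L w₁ +L w₂) +L negL ((q *L Pa) *L (q *L B *L w₁ +L w₂))
    ≃ q *L (A *L (q *L (B +L P) *L w₁ +L w₂) +L Pa *L (q *L P) *L w₁) +L (q *L (B +L P) *L w₁ +L w₂)
  collect = solve-∀ laurentACR
  numerator : toL (qNumer (suc (suc a) ∷ s)) ≃ q *L (prefactor (a ∷ b ∷ r) *L K⁺ true (a ∷ b ∷ r))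
                                               +L prefactor (a ∷ b ∷ r) *L K⁺ false (b ∷ r)
  numerator = begin
    toL (qNumer (suc (suc a) ∷ s))
      ≈⟨ qNumer-cons (suc (suc a)) s ⟩
    toL (qint (suc (suc a))) *L toL (qNumer s) +L negL (qpowL (suc a) *L toL (qDenom s))
      ≈⟨ +L-cong (*L-cong (≃-trans (qintL-sucˡ (suc a)) (+L-cong (≃-refl {1L}) (*L-cong (≃-refl {q}) (qintL-sucʳ a))))
                          qNumer-block)
                 (negL-cong (*L-cong (qpowL-suc a) qDenom-block)) ⟩
    (1L +L q *L (A +L Pa)) *L X +L negL ((q *L Pa) *L Y)
      ≈⟨ collect q A Pa B P w₁ w₂ ⟩
    q *L (A *L X +L Pa *L (q *L P) *L w₁) +L X
      ≈⟨ +L-cong (*L-cong (≃-refl {q}) K⁺-true-block) K⁺-false-block ⟨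
    q *L (prefactor (a ∷ b ∷ r) *L K⁺ true (a ∷ b ∷ r)) +L prefactor (a ∷ b ∷ r) *L K⁺ false (b ∷ r) ∎

qCF-regToNeg : ∀ a b r → Paired (a ∷ b ∷ r) →
  toL (qNumer (regToNeg (a ∷ b ∷ r))) ≃ prefactor (a ∷ b ∷ r) *L K⁺ true (a ∷ b ∷ r)
  × toL (qDenom (regToNeg (a ∷ b ∷ r))) ≃ prefactor (a ∷ b ∷ r) *L K⁺ false (b ∷ r)
qCF-regToNeg a (suc b′) r (pair p) with qCF-regToNegTail r p
... | hN , hD = numerator , ≃-trans qNumer-block (≃-sym K⁺-false-block)
  where
  open RegToNegStep a b′ r hN hD
  open ≃-Reasoning
  collect : ∀ q A Pa B P w₁ w₂ →
    (A +L Pa) *L (q *L (B +L P) *L w₁ +L w₂) +L negL (Pa *L (q *L B *L w₁ +L w₂))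
    ≃ A *L (q *L (B +L P) *L w₁ +L w₂) +L Pa *L (q *L P) *L w₁
  collect = solve-∀ laurentACR
  numerator : toL (qNumer (suc a ∷ s)) ≃ prefactor (a ∷ b ∷ r) *L K⁺ true (a ∷ b ∷ r)
  numerator = begin
    toL (qNumer (suc a ∷ s))
      ≈⟨ qNumer-cons (suc a) s ⟩
    toL (qint (suc a)) *L toL (qNumer s) +L negL (qpowL a *L toL (qDenom s))
      ≈⟨ +L-cong (*L-cong (qintL-sucʳ a) qNumer-block) (negL-cong (*L-cong (≃-refl {Pa}) qDenom-block)) ⟩
    (A +L Pa) *L X +L negL (Pa *L Y)
      ≈⟨ collect q A Pa B P w₁ w₂ ⟩
    A *L X +L Pa *L (q *L P) *L w₁
      ≈⟨ K⁺-true-block ⟨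
    prefactor (a ∷ b ∷ r) *L K⁺ true (a ∷ b ∷ r) ∎

-- Specialisation at q = 1

eval1-+P : ∀ P Q → eval1 (P +P Q) ≡ eval1 P ℤ.+ eval1 Q
eval1-+P []      Q       = sym (ℤP.+-identityˡ _)
eval1-+P (x ∷ p) []      = sym (ℤP.+-identityʳ _)
eval1-+P (x ∷ p) (y ∷ q) = trans (cong (λ z → (x ℤ.+ y) ℤ.+ z) (eval1-+P p q)) (interchange x y (eval1 p) (eval1 q))
  where
  interchange : ∀ x y a b → (x ℤ.+ y) ℤ.+ (a ℤ.+ b) ≡ (x ℤ.+ a) ℤ.+ (y ℤ.+ b)
  interchange = solveℤ

eval1-scaleP : ∀ c P → eval1 (scaleP c P) ≡ c ℤ.* eval1 P
eval1-scaleP c []      = sym (ℤP.*-zeroʳ c)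
eval1-scaleP c (x ∷ p) = trans (cong (λ z → c ℤ.* x ℤ.+ z) (eval1-scaleP c p)) (sym (ℤP.*-distribˡ-+ c x (eval1 p)))

eval1-negP : ∀ P → eval1 (negP P) ≡ ℤ.- eval1 P
eval1-negP []      = refl
eval1-negP (x ∷ p) = trans (cong (λ z → ℤ.- x ℤ.+ z) (eval1-negP p)) (sym (ℤP.neg-distrib-+ x (eval1 p)))

eval1-*P : ∀ P Q → eval1 (P *P Q) ≡ eval1 P ℤ.* eval1 Q
eval1-*P []      Q = sym (ℤP.*-zeroˡ (eval1 Q))
eval1-*P (x ∷ p) Q = begin
  eval1 (scaleP x Q +P shift (p *P Q))               ≡⟨ eval1-+P (scaleP x Q) (shift (p *P Q)) ⟩
  eval1 (scaleP x Q) ℤ.+ (+ 0 ℤ.+ eval1 (p *P Q))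
    ≡⟨ cong₂ (λ a b → a ℤ.+ (+ 0 ℤ.+ b)) (eval1-scaleP x Q) (eval1-*P p Q) ⟩
  x ℤ.* eval1 Q ℤ.+ (+ 0 ℤ.+ eval1 p ℤ.* eval1 Q)   ≡⟨ factor x (eval1 p) (eval1 Q) ⟩
  (x ℤ.+ eval1 p) ℤ.* eval1 Q                       ∎
  where
  open ≡-Reasoning
  factor : ∀ x a b → x ℤ.* b ℤ.+ (+ 0 ℤ.+ a ℤ.* b) ≡ (x ℤ.+ a) ℤ.* b
  factor = solveℤ

eval1-zero : ∀ P → P ≈P [] → eval1 P ≡ + 0
eval1-zero []      h = refl
eval1-zero (x ∷ p) h = cong₂ ℤ._+_ (h 0) (eval1-zero p (λ n → h (suc n)))

eval1-cong : ∀ {P Q} → P ≋ Q → eval1 P ≡ eval1 Q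
eval1-cong {[]}    {Q}     ⟨ h ⟩ = sym (eval1-zero Q (λ n → sym (h n)))
eval1-cong {x ∷ p} {[]}    ⟨ h ⟩ = eval1-zero (x ∷ p) h
eval1-cong {x ∷ p} {y ∷ q} ⟨ h ⟩ = cong₂ ℤ._+_ (h 0) (eval1-cong {p} {q} ⟨ (λ n → h (suc n)) ⟩)

eval1-qpow : ∀ k → eval1 (qpow k) ≡ + 1
eval1-qpow zero    = refl
eval1-qpow (suc k) = trans (ℤP.+-identityˡ _) (eval1-qpow k)

eval1-qint : ∀ c → eval1 (qint c) ≡ + c
eval1-qint zero    = refl
eval1-qint (suc c) = trans (eval1-+P (qint c) (qpow c))
  (trans (cong₂ ℤ._+_ (eval1-qint c) (eval1-qpow c)) (trans (ℤP.+-comm (+ c) (+ 1)) (sym (ℤP.pos-+ 1 c))))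

eval1-qCF : ∀ cs → eval1 (qNumer cs) ≡ proj₁ (negCF cs) × eval1 (qDenom cs) ≡ proj₂ (negCF cs)
eval1-qCF []      = refl , refl
eval1-qCF (c ∷ t) with eval1-qCF t
... | evalN , evalD = numerator , evalN
  where
  open ≡-Reasoning
  N D : Poly
  N = qNumer t
  D = qDenom t
  numerator : eval1 (qint c *P N +P negP (qpow (c ∸ 1) *P D)) ≡ + c ℤ.* proj₁ (negCF t) ℤ.- proj₂ (negCF t)
  numerator = begin
    eval1 (qint c *P N +P negP (qpow (c ∸ 1) *P D))
      ≡⟨ eval1-+P (qint c *P N) (negP (qpow (c ∸ 1) *P D)) ⟩
    eval1 (qint c *P N) ℤ.+ eval1 (negP (qpow (c ∸ 1) *P D))
      ≡⟨ cong₂ ℤ._+_ (eval1-*P (qint c) N)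
                     (trans (eval1-negP (qpow (c ∸ 1) *P D)) (cong ℤ.-_ (eval1-*P (qpow (c ∸ 1)) D))) ⟩
    eval1 (qint c) ℤ.* eval1 N ℤ.- eval1 (qpow (c ∸ 1)) ℤ.* eval1 D
      ≡⟨ cong₂ (λ x y → x ℤ.* eval1 N ℤ.- y ℤ.* eval1 D) (eval1-qint c) (eval1-qpow (c ∸ 1)) ⟩
    + c ℤ.* eval1 N ℤ.- + 1 ℤ.* eval1 D
      ≡⟨ cong₂ (λ x y → + c ℤ.* x ℤ.- y) evalN (trans (ℤP.*-identityˡ (eval1 D)) evalD) ⟩
    + c ℤ.* proj₁ (negCF t) ℤ.- proj₂ (negCF t) ∎

-- Coprimality

data Normal : Poly → Set where
  lead : ∀ {x} → x ≢ + 0 → Normal (x ∷ [])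
  cons : ∀ {x p} → Normal p → Normal (x ∷ p)

degree : ∀ {P} → Normal P → ℕ
degree (lead _) = 0
degree (cons h) = suc (degree h)

leadCoeff : ∀ {P} → Normal P → ℤ
leadCoeff (lead {x} _) = x
leadCoeff (cons h)     = leadCoeff h

leadCoeff≢0 : ∀ {P} (h : Normal P) → leadCoeff h ≢ + 0
leadCoeff≢0 (lead x≢0) = x≢0
leadCoeff≢0 (cons h)   = leadCoeff≢0 h

coeff-degree : ∀ {P} (h : Normal P) → coeff P (degree h) ≡ leadCoeff h
coeff-degree (lead _) = refl
coeff-degree (cons h) = coeff-degree h

coeff>degree : ∀ {P} (h : Normal P) n → degree h ℕ.< n → coeff P n ≡ + 0
coeff>degree (lead _) (suc zero)    _         = refl
coeff>degree (lead _) (suc (suc n)) _         = refl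
coeff>degree (cons h) (suc n)       (s≤s lt) = coeff>degree h n lt

coeff-*P-degree : ∀ {P Q} (h : Normal P) (g : Normal Q) →
  coeff (P *P Q) (degree h ℕ.+ degree g) ≡ leadCoeff h ℤ.* leadCoeff g
coeff-*P-degree {x ∷ []} {Q} (lead _) g = begin
  coeff (scaleP x Q +P shift []) (degree g)
    ≡⟨ coeff-+P (scaleP x Q) (shift []) (degree g) ⟩
  coeff (scaleP x Q) (degree g) ℤ.+ coeff (shift []) (degree g)
    ≡⟨ cong₂ ℤ._+_ (trans (coeff-scaleP x Q (degree g)) (cong (x ℤ.*_) (coeff-degree g))) (coeff-zero (degree g)) ⟩
  x ℤ.* leadCoeff g ℤ.+ + 0
    ≡⟨ ℤP.+-identityʳ _ ⟩
  x ℤ.* leadCoeff g ∎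
  where
  open ≡-Reasoning
  coeff-zero : ∀ n → coeff (shift []) n ≡ + 0
  coeff-zero zero    = refl
  coeff-zero (suc n) = refl
coeff-*P-degree {x ∷ p} {Q} (cons h) g = begin
  coeff (scaleP x Q +P shift (p *P Q)) (suc (degree h ℕ.+ degree g))
    ≡⟨ coeff-+P (scaleP x Q) (shift (p *P Q)) (suc (degree h ℕ.+ degree g)) ⟩
  coeff (scaleP x Q) (suc (degree h ℕ.+ degree g)) ℤ.+ coeff (p *P Q) (degree h ℕ.+ degree g)
    ≡⟨ cong₂ ℤ._+_ (trans (coeff-scaleP x Q _) (trans (cong (x ℤ.*_) (coeff>degree g _ beyond)) (ℤP.*-zeroʳ x)))
                   (coeff-*P-degree h g) ⟩
  + 0 ℤ.+ leadCoeff h ℤ.* leadCoeff g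
    ≡⟨ ℤP.+-identityˡ _ ⟩
  leadCoeff h ℤ.* leadCoeff g ∎
  where
  open ≡-Reasoning
  beyond : degree g ℕ.< suc (degree h ℕ.+ degree g)
  beyond = s≤s (ℕP.m≤n+m (degree g) (degree h))

normalise : ∀ P → P ≋ [] ⊎ Σ Poly λ P′ → Normal P′ × P′ ≋ P
normalise []      = inj₁ ≋-refl
normalise (x ∷ p) with normalise p
... | inj₂ (p′ , h , e) = inj₂ (x ∷ p′ , cons h , ⟨ (λ { zero → refl ; (suc n) → coeff≡ e n }) ⟩)
... | inj₁ e with x ℤ.≟ + 0
...   | yes x≡0 = inj₁ ⟨ (λ { zero → x≡0 ; (suc n) → coeff≡ e n }) ⟩
...   | no x≢0  = inj₂ (x ∷ [] , lead x≢0 , ⟨ (λ { zero → refl ; (suc n) → sym (coeff≡ e n) }) ⟩)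

0P≉1P : ¬ [] ≋ 1P
0P≉1P ⟨ h ⟩ with h 0
... | ()

-- ℤ has no zero divisors, so degrees add and a factorisation of 1 has degree 0.
unit⇒constant : ∀ T E → T *P E ≋ 1P → Σ ℤ λ a → T ≋ a ∷ [] × ∃ λ b → a ℤ.* b ≡ + 1
unit⇒constant T E TE≋1 with normalise T | normalise E
... | inj₁ T≋0 | _ = ⊥-elim (0P≉1P (≋-trans (≋-sym (*P-congʳ E T≋0)) TE≋1))
... | inj₂ _   | inj₁ E≋0 =
  ⊥-elim (0P≉1P (≋-trans (≋-sym (≋-trans (*P-cong (≋-refl {T}) E≋0) (*P-zeroʳ T))) TE≋1))
... | inj₂ (T′ , h , T′≋T) | inj₂ (E′ , g , E′≋E) =
  constant h g T′≋T (≋-trans (*P-cong T′≋T E′≋E) TE≋1)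
  where
  positiveDegree : ∀ {T′ E′} (h : Normal T′) (g : Normal E′) → T′ *P E′ ≋ 1P →
    ∀ k → degree h ℕ.+ degree g ≡ suc k → ⊥
  positiveDegree h g ⟨ e ⟩ k deg≡ with ℤP.i*j≡0⇒i≡0∨j≡0 (leadCoeff h) {leadCoeff g}
    (trans (sym (coeff-*P-degree h g)) (trans (e (degree h ℕ.+ degree g)) (subst (λ n → coeff 1P n ≡ + 0) (sym deg≡) refl)))
  ... | inj₁ h≡0 = leadCoeff≢0 h h≡0
  ... | inj₂ g≡0 = leadCoeff≢0 g g≡0
  constant : ∀ {T′ E′} (h : Normal T′) (g : Normal E′) → T′ ≋ T → T′ *P E′ ≋ 1P →
    Σ ℤ λ a → T ≋ a ∷ [] × ∃ λ b → a ℤ.* b ≡ + 1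
  constant (lead {a} _)   (lead {b} _)   T′≋T e =
    a , ≋-sym T′≋T , b , trans (sym (ℤP.+-identityʳ (a ℤ.* b))) (coeff≡ e 0)
  constant h@(lead _)     g@(cons _)     T′≋T e = ⊥-elim (positiveDegree h g e _ refl)
  constant h@(cons _)     g              T′≋T e = ⊥-elim (positiveDegree h g e _ refl)

qCF-bezout : ∀ cs → Σ Poly λ X → Σ Poly λ Y → Σ ℕ λ e → qNumer cs *P X +P qDenom cs *P Y ≋ qpow e
qCF-bezout []      = 1P , [] , 0 , ⟨ (λ { zero → refl ; (suc n) → refl }) ⟩
qCF-bezout (c ∷ t) with qCF-bezout t
... | X , Y , e , bezout =
  negP Y , qpow (c ∸ 1) *P X +P qint c *P Y , (c ∸ 1) ℕ.+ e ,
  ≋-trans (step (qint c) (qNumer t) (qpow (c ∸ 1)) (qDenom t) X Y)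
          (≋-trans (*P-cong (≋-refl {qpow (c ∸ 1)}) bezout) (≋-sym (qpow-+ (c ∸ 1) e)))
  where
  step : ∀ C N Q D X Y → (C *P N +P negP (Q *P D)) *P negP Y +P N *P (Q *P X +P C *P Y) ≋ Q *P (N *P X +P D *P Y)
  step = solve-∀ polyACR

coeff₀-*P : ∀ P Q → coeff (P *P Q) 0 ≡ coeff P 0 ℤ.* coeff Q 0
coeff₀-*P []      Q = sym (ℤP.*-zeroˡ (coeff Q 0))
coeff₀-*P (x ∷ p) Q = trans (coeff-+P (scaleP x Q) (shift (p *P Q)) 0) (trans (ℤP.+-identityʳ _) (coeff-scaleP x Q 0))

coeff₀-qint : ∀ k → coeff (qint (suc k)) 0 ≡ + 1
coeff₀-qint zero    = refl
coeff₀-qint (suc k) = trans (coeff-+P (qint (suc k)) (qpow (suc k)) 0) (cong (ℤ._+ + 0) (coeff₀-qint k))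

coeff₀-qNumer : ∀ cs → All (2 ℕ.≤_) cs → coeff (qNumer cs) 0 ≡ + 1
coeff₀-qNumer []                 []        = refl
coeff₀-qNumer (suc zero ∷ t)     (s≤s () ∷ _)
coeff₀-qNumer (suc (suc c) ∷ t) (_ ∷ t≥2) = begin
  coeff (qint (suc (suc c)) *P qNumer t +P negP (qpow (suc c) *P qDenom t)) 0
    ≡⟨ coeff-+P (qint (suc (suc c)) *P qNumer t) (negP (qpow (suc c) *P qDenom t)) 0 ⟩
  coeff (qint (suc (suc c)) *P qNumer t) 0 ℤ.+ coeff (negP (qpow (suc c) *P qDenom t)) 0
    ≡⟨ cong₂ ℤ._+_
         (trans (coeff₀-*P (qint (suc (suc c))) (qNumer t)) (cong₂ ℤ._*_ (coeff₀-qint (suc c)) (coeff₀-qNumer t t≥2)))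
         (trans (coeff-negP (qpow (suc c) *P qDenom t) 0)
                (cong ℤ.-_ (trans (coeff₀-*P (qpow (suc c)) (qDenom t)) (ℤP.*-zeroˡ (coeff (qDenom t) 0))))) ⟩
  + 1 ∎
  where open ≡-Reasoning

tailP : Poly → Poly
tailP []      = []
tailP (x ∷ p) = p

shift-tailP : ∀ T → coeff T 0 ≡ + 0 → T ≋ shift (tailP T)
shift-tailP []      _  = ⟨ (λ { zero → refl ; (suc n) → refl }) ⟩
shift-tailP (x ∷ p) x≡0 = ⟨ (λ { zero → x≡0 ; (suc n) → refl }) ⟩

*P-shift : ∀ N T → N *P shift T ≋ shift (N *P T)
*P-shift N T = ≋-trans (*P-comm N (shift T)) (≋-trans (shift-*P T N) (shift-cong (*P-comm T N)))

-- Since N has constant term 1, q ∣ N·T forces q ∣ T.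
cancel-qpow : ∀ e {N D R S} T → coeff N 0 ≡ + 1 → qpow e *P R ≋ N *P T → qpow e *P S ≋ D *P T →
  Σ Poly λ T′ → R ≋ N *P T′ × S ≋ D *P T′
cancel-qpow zero    {R = R} {S} T _ hR hS = T , ≋-trans (≋-sym (*P-identityˡ R)) hR , ≋-trans (≋-sym (*P-identityˡ S)) hS
cancel-qpow (suc e) {N} {D} {R} {S} T N₀≡1 hR hS = cancel-qpow e {N} {D} (tailP T) N₀≡1 (divide {F = N} hR) (divide {F = D} hS)
  where
  T₀≡0 : coeff T 0 ≡ + 0
  T₀≡0 = begin
    coeff T 0                    ≡⟨ ℤP.*-identityˡ (coeff T 0) ⟨
    + 1 ℤ.* coeff T 0            ≡⟨ cong (ℤ._* coeff T 0) N₀≡1 ⟨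
    coeff N 0 ℤ.* coeff T 0      ≡⟨ coeff₀-*P N T ⟨
    coeff (N *P T) 0             ≡⟨ coeff≡ hR 0 ⟨
    coeff (shift (qpow e) *P R) 0 ≡⟨ coeff≡ (shift-*P (qpow e) R) 0 ⟩
    + 0                          ∎
    where open ≡-Reasoning
  divide : ∀ {M F} → shift (qpow e) *P M ≋ F *P T → qpow e *P M ≋ F *P tailP T
  divide {M} {F} h = shift-cancel (≋-trans (≋-sym (shift-*P (qpow e) M))
    (≋-trans h (≋-trans (*P-cong (≋-refl {F}) (shift-tailP T T₀≡0)) (*P-shift F (tailP T)))))

-- A Bézout identity N X + D Y = q^e with N(0) = 1 shows that every common multiple
-- relation R D = S N comes from a common factor T′; coprimality makes T′ a unit.
coprime-qCF : ∀ cs → All (2 ℕ.≤_) cs → ∀ R S → CoprimeP R S → R *P qDenom cs ≈P S *P qNumer cs →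
  Σ ℤ λ a → R ≋ qNumer cs *P (a ∷ []) × S ≋ qDenom cs *P (a ∷ []) × ∃ λ b → a ℤ.* b ≡ + 1
coprime-qCF cs cs≥2 R S coprime RD≈SN with qCF-bezout cs
... | X , Y , e , bezout with cancel-qpow e {N} {D} {R} {S} (R *P X +P S *P Y) (coeff₀-qNumer cs cs≥2) qeR qeS
  where
  open ≋-Reasoning
  N D : Poly
  N = qNumer cs
  D = qDenom cs
  RD≋SN : R *P D ≋ S *P N
  RD≋SN = ⟨ RD≈SN ⟩
  qeR : qpow e *P R ≋ N *P (R *P X +P S *P Y)
  qeR = begin
    qpow e *P R                   ≈⟨ *P-cong (≋-sym bezout) (≋-refl {R}) ⟩
    (N *P X +P D *P Y) *P R       ≈⟨ expand N X D Y R ⟩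
    N *P (R *P X) +P (R *P D) *P Y ≈⟨ +P-cong (≋-refl {N *P (R *P X)}) (*P-cong RD≋SN (≋-refl {Y})) ⟩
    N *P (R *P X) +P (S *P N) *P Y ≈⟨ collect N R X S Y ⟩
    N *P (R *P X +P S *P Y)       ∎
    where
    expand : ∀ N X D Y R → (N *P X +P D *P Y) *P R ≋ N *P (R *P X) +P (R *P D) *P Y
    expand = solve-∀ polyACR
    collect : ∀ N R X S Y → N *P (R *P X) +P (S *P N) *P Y ≋ N *P (R *P X +P S *P Y)
    collect = solve-∀ polyACR
  qeS : qpow e *P S ≋ D *P (R *P X +P S *P Y)
  qeS = begin
    qpow e *P S                    ≈⟨ *P-cong (≋-sym bezout) (≋-refl {S}) ⟩
    (N *P X +P D *P Y) *P S        ≈⟨ expand N X D Y S ⟩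
    (S *P N) *P X +P D *P (S *P Y) ≈⟨ +P-cong (*P-cong (≋-sym RD≋SN) (≋-refl {X})) (≋-refl {D *P (S *P Y)}) ⟩
    (R *P D) *P X +P D *P (S *P Y) ≈⟨ collect D R X S Y ⟩
    D *P (R *P X +P S *P Y)        ∎
    where
    expand : ∀ N X D Y S → (N *P X +P D *P Y) *P S ≋ (S *P N) *P X +P D *P (S *P Y)
    expand = solve-∀ polyACR
    collect : ∀ D R X S Y → (R *P D) *P X +P D *P (S *P Y) ≋ D *P (R *P X +P S *P Y)
    collect = solve-∀ polyACR
... | T , R≋NT , S≋DT with coprime T (qNumer cs , coeff≡ (≋-trans (*P-comm T (qNumer cs)) (≋-sym R≋NT)))
                                      (qDenom cs , coeff≡ (≋-trans (*P-comm T (qDenom cs)) (≋-sym S≋DT)))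
... | E , TE≈1 with unit⇒constant T E ⟨ TE≈1 ⟩
... | a , T≋a , unit = a , ≋-trans R≋NT (*P-cong (≋-refl {qNumer cs}) T≋a)
                         , ≋-trans S≋DT (*P-cong (≋-refl {qDenom cs}) T≋a) , unit

-- Uniqueness of negative expansions

negCFℕ : List ℕ → ℕ × ℕ
negCFℕ []      = (1 , 0)
negCFℕ (c ∷ t) = (c * proj₁ (negCFℕ t) ∸ proj₂ (negCFℕ t) , proj₁ (negCFℕ t))

negCFℕ-den<num : ∀ cs → All (2 ≤_) cs → proj₂ (negCFℕ cs) < proj₁ (negCFℕ cs)

negCFℕ-den≤c*num : ∀ {c} t → 2 ≤ c → All (2 ≤_) t → proj₂ (negCFℕ t) ≤ c * proj₁ (negCFℕ t)
negCFℕ-den≤c*num {c} t c≥2 t≥2 = ℕP.≤-trans (ℕP.<⇒≤ (negCFℕ-den<num t t≥2))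
  (ℕP.≤-trans (ℕP.m≤m+n P (1 * P)) (ℕP.*-monoˡ-≤ P c≥2))
  where
  P : ℕ
  P = proj₁ (negCFℕ t)

negCFℕ-den<num []      []            = s≤s z≤n
negCFℕ-den<num (c ∷ t) (c≥2 ∷ t≥2) = ℕP.m+n≤o⇒m≤o∸n (suc P) (begin
  suc P ℕ.+ Q   ≡⟨ ℕP.+-suc P Q ⟨
  P ℕ.+ suc Q   ≤⟨ ℕP.+-monoʳ-≤ P (negCFℕ-den<num t t≥2) ⟩
  P ℕ.+ P       ≡⟨ cong (P ℕ.+_) (ℕP.+-identityʳ P) ⟨
  2 * P         ≤⟨ ℕP.*-monoˡ-≤ P c≥2 ⟩
  c * P         ∎)
  where
  open ℕP.≤-Reasoning
  P Q : ℕ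
  P = proj₁ (negCFℕ t)
  Q = proj₂ (negCFℕ t)

negCFℕ-num>0 : ∀ cs → All (2 ≤_) cs → 0 < proj₁ (negCFℕ cs)
negCFℕ-num>0 cs cs≥2 = ℕP.≤-<-trans z≤n (negCFℕ-den<num cs cs≥2)

negCF≡negCFℕ : ∀ cs → All (2 ≤_) cs →
  proj₁ (negCF cs) ≡ + proj₁ (negCFℕ cs) × proj₂ (negCF cs) ≡ + proj₂ (negCFℕ cs)
negCF≡negCFℕ []      []            = refl , refl
negCF≡negCFℕ (c ∷ t) (c≥2 ∷ t≥2) with negCF≡negCFℕ t t≥2
... | num≡ , den≡ = numerator , num≡
  where
  open ≡-Reasoning
  P Q : ℕ
  P = proj₁ (negCFℕ t)
  Q = proj₂ (negCFℕ t)
  numerator : + c ℤ.* proj₁ (negCF t) ℤ.- proj₂ (negCF t) ≡ + (c * P ∸ Q)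
  numerator = begin
    + c ℤ.* proj₁ (negCF t) ℤ.- proj₂ (negCF t) ≡⟨ cong₂ (λ x y → + c ℤ.* x ℤ.- y) num≡ den≡ ⟩
    + c ℤ.* + P ℤ.- + Q                         ≡⟨ cong (ℤ._- + Q) (ℤP.pos-* c P) ⟨
    + (c * P) ℤ.- + Q                           ≡⟨ ℤP.m-n≡m⊖n (c * P) Q ⟩
    (c * P) ℤ.⊖ Q                               ≡⟨ ℤP.⊖-≥ (negCFℕ-den≤c*num t c≥2 t≥2) ⟩
    + (c * P ∸ Q)                               ∎

quotient-unique : ∀ {c c′ ρ ρ′ M} .{{_ : ℕ.NonZero M}} → ρ < M → ρ′ < M →
  ρ ℕ.+ c * M ≡ ρ′ ℕ.+ c′ * M → c ≡ c′ × ρ ≡ ρ′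
quotient-unique {c} {c′} {ρ} {ρ′} {M} ρ<M ρ′<M eq =
  c≡c′ , ℕP.+-cancelʳ-≡ _ ρ ρ′ (trans eq (cong (λ k → ρ′ ℕ.+ k * M) (sym c≡c′)))
  where
  quotient : ∀ {ρ} k → ρ < M → (ρ ℕ.+ k * M) / M ≡ k
  quotient {ρ} k ρ<M = trans (+-distrib-/-∣ʳ ρ (divides k refl)) (cong₂ ℕ._+_ (m<n⇒m/n≡0 ρ<M) (m*n/n≡m k M))
  c≡c′ : c ≡ c′
  c≡c′ = trans (sym (quotient c ρ<M)) (trans (cong (_/ M) eq) (quotient c′ ρ′<M))

-- The first entry is the quotient: x = c − Q/P with 0 ≤ Q/P < 1, so c is the ceiling of x.
negCFℕ-injective : ∀ cs cs′ → All (2 ≤_) cs → All (2 ≤_) cs′ →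
  proj₁ (negCFℕ cs) * proj₂ (negCFℕ cs′) ≡ proj₁ (negCFℕ cs′) * proj₂ (negCFℕ cs) → cs ≡ cs′
negCFℕ-injective []      []        _ _ _ = refl
negCFℕ-injective []      (c′ ∷ t′) _ (_ ∷ t′≥2) h =
  ⊥-elim (ℕP.<⇒≢ (negCFℕ-num>0 t′ t′≥2)
    (sym (trans (sym (ℕP.+-identityʳ _)) (trans h (ℕP.*-zeroʳ (proj₁ (negCFℕ (c′ ∷ t′))))))))
negCFℕ-injective (c ∷ t) []        (_ ∷ t≥2) _ h =
  ⊥-elim (ℕP.<⇒≢ (negCFℕ-num>0 t t≥2)
    (trans (sym (ℕP.*-zeroʳ (proj₁ (negCFℕ (c ∷ t))))) (trans h (ℕP.+-identityʳ _))))
negCFℕ-injective (c ∷ t) (c′ ∷ t′) (c≥2 ∷ t≥2) (c′≥2 ∷ t′≥2) h =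
  cong₂ _∷_ (proj₁ quotients)
    (negCFℕ-injective t t′ t≥2 t′≥2 (trans (ℕP.*-comm P Q′) (trans (proj₂ quotients) (ℕP.*-comm Q P′))))
  where
  open ≡-Reasoning
  P Q P′ Q′ X Y : ℕ
  P  = proj₁ (negCFℕ t)
  Q  = proj₂ (negCFℕ t)
  P′ = proj₁ (negCFℕ t′)
  Q′ = proj₂ (negCFℕ t′)
  X  = c * P ∸ Q
  Y  = c′ * P′ ∸ Q′
  X+Q≡cP : X ℕ.+ Q ≡ c * P
  X+Q≡cP = ℕP.m∸n+n≡m (negCFℕ-den≤c*num t c≥2 t≥2)
  Y+Q′≡c′P′ : Y ℕ.+ Q′ ≡ c′ * P′
  Y+Q′≡c′P′ = ℕP.m∸n+n≡m (negCFℕ-den≤c*num t′ c′≥2 t′≥2)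
  key : Q′ * P ℕ.+ c * (P * P′) ≡ Q * P′ ℕ.+ c′ * (P * P′)
  key = begin
    Q′ * P ℕ.+ c * (P * P′)        ≡⟨ cong (λ z → Q′ * P ℕ.+ z) (ℕP.*-assoc c P P′) ⟨
    Q′ * P ℕ.+ c * P * P′          ≡⟨ cong (λ z → Q′ * P ℕ.+ z * P′) X+Q≡cP ⟨
    Q′ * P ℕ.+ (X ℕ.+ Q) * P′      ≡⟨ regroup Q′ P X Q P′ ⟩
    Q * P′ ℕ.+ (X * P′ ℕ.+ Q′ * P) ≡⟨ cong (λ z → Q * P′ ℕ.+ (z ℕ.+ Q′ * P)) h ⟩
    Q * P′ ℕ.+ (Y * P ℕ.+ Q′ * P)  ≡⟨ cong (Q * P′ ℕ.+_) (ℕP.*-distribʳ-+ P Y Q′) ⟨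
    Q * P′ ℕ.+ (Y ℕ.+ Q′) * P      ≡⟨ cong (λ z → Q * P′ ℕ.+ z * P) Y+Q′≡c′P′ ⟩
    Q * P′ ℕ.+ c′ * P′ * P         ≡⟨ cong (Q * P′ ℕ.+_) (reassociate c′ P′ P) ⟩
    Q * P′ ℕ.+ c′ * (P * P′)       ∎
    where
    regroup : ∀ Q′ P X Q P′ → Q′ * P ℕ.+ (X ℕ.+ Q) * P′ ≡ Q * P′ ℕ.+ (X * P′ ℕ.+ Q′ * P)
    regroup = solveℕ
    reassociate : ∀ c′ P′ P → c′ * P′ * P ≡ c′ * (P * P′)
    reassociate = solveℕ
  quotients : c ≡ c′ × Q′ * P ≡ Q * P′
  quotients = quotient-unique {{ℕP.m*n≢0 P P′ {{P≢0}} {{P′≢0}}}}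
    (ℕP.<-≤-trans (ℕP.*-monoˡ-< P {{P≢0}} (negCFℕ-den<num t′ t′≥2)) (ℕP.≤-reflexive (ℕP.*-comm P′ P)))
    (ℕP.*-monoˡ-< P′ {{P′≢0}} (negCFℕ-den<num t t≥2))
    key
    where
    P≢0 : ℕ.NonZero P
    P≢0 = ℕ.>-nonZero (negCFℕ-num>0 t t≥2)
    P′≢0 : ℕ.NonZero P′
    P′≢0 = ℕ.>-nonZero (negCFℕ-num>0 t′ t′≥2)

negCF-twos : ∀ n t w₁ w₂ → proj₁ (negCF t) ≡ w₁ ℤ.+ w₂ → proj₂ (negCF t) ≡ w₂ →
  proj₁ (negCF (twos n ++ t)) ≡ + suc n ℤ.* w₁ ℤ.+ w₂ × proj₂ (negCF (twos n ++ t)) ≡ + n ℤ.* w₁ ℤ.+ w₂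
negCF-twos zero    t w₁ w₂ num≡ den≡ = trans num≡ (one w₁ w₂) , trans den≡ (zero′ w₁ w₂)
  where
  one : ∀ w₁ w₂ → w₁ ℤ.+ w₂ ≡ + 1 ℤ.* w₁ ℤ.+ w₂
  one = solveℤ
  zero′ : ∀ w₁ w₂ → w₂ ≡ + 0 ℤ.* w₁ ℤ.+ w₂
  zero′ = solveℤ
negCF-twos (suc n) t w₁ w₂ num≡ den≡ with negCF-twos n t w₁ w₂ num≡ den≡
... | num≡′ , den≡′ = numerator , num≡′
  where
  open ≡-Reasoning
  s : List ℕ
  s = twos n ++ t
  step : ∀ n w₁ w₂ →
    + 2 ℤ.* ((+ 1 ℤ.+ n) ℤ.* w₁ ℤ.+ w₂) ℤ.- (n ℤ.* w₁ ℤ.+ w₂) ≡ (+ 2 ℤ.+ n) ℤ.* w₁ ℤ.+ w₂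
  step = solveℤ
  numerator : + 2 ℤ.* proj₁ (negCF s) ℤ.- proj₂ (negCF s) ≡ + suc (suc n) ℤ.* w₁ ℤ.+ w₂
  numerator = begin
    + 2 ℤ.* proj₁ (negCF s) ℤ.- proj₂ (negCF s)
      ≡⟨ cong₂ (λ x y → + 2 ℤ.* x ℤ.- y) (trans num≡′ (cong (λ k → k ℤ.* w₁ ℤ.+ w₂) (ℤP.pos-+ 1 n))) den≡′ ⟩
    + 2 ℤ.* ((+ 1 ℤ.+ + n) ℤ.* w₁ ℤ.+ w₂) ℤ.- (+ n ℤ.* w₁ ℤ.+ w₂)
      ≡⟨ step (+ n) w₁ w₂ ⟩
    (+ 2 ℤ.+ + n) ℤ.* w₁ ℤ.+ w₂
      ≡⟨ cong (λ k → k ℤ.* w₁ ℤ.+ w₂) (ℤP.pos-+ 2 n) ⟨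
    + suc (suc n) ℤ.* w₁ ℤ.+ w₂ ∎

regCF-cons : ∀ a t → + proj₁ (regCF (a ∷ t)) ≡ + a ℤ.* + proj₁ (regCF t) ℤ.+ + proj₂ (regCF t)
regCF-cons a t = trans (ℤP.pos-+ (a ℕ.* proj₁ (regCF t)) (proj₂ (regCF t)))
                       (cong (ℤ._+ + proj₂ (regCF t)) (ℤP.pos-* a (proj₁ (regCF t))))

module TwosBlock (b : ℕ) (r : List ℕ)
  (num≡ : proj₁ (negCF (regToNegTail r)) ≡ + proj₁ (regCF r) ℤ.+ + proj₂ (regCF r))
  (den≡ : proj₂ (negCF (regToNegTail r)) ≡ + proj₂ (regCF r)) where

  k₁ k₂ B : ℤ
  k₁ = + proj₁ (regCF r)
  k₂ = + proj₂ (regCF r)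
  B  = + b

  s : List ℕ
  s = twos b ++ regToNegTail r

  twos-numer : proj₁ (negCF s) ≡ (+ 1 ℤ.+ B) ℤ.* k₁ ℤ.+ k₂
  twos-numer = trans (proj₁ (negCF-twos b (regToNegTail r) k₁ k₂ num≡ den≡))
                     (cong (λ k → k ℤ.* k₁ ℤ.+ k₂) (ℤP.pos-+ 1 b))

  twos-denom : proj₂ (negCF s) ≡ B ℤ.* k₁ ℤ.+ k₂
  twos-denom = proj₂ (negCF-twos b (regToNegTail r) k₁ k₂ num≡ den≡)

  regCF-block : + proj₁ (regCF (suc b ∷ r)) ≡ (+ 1 ℤ.+ B) ℤ.* k₁ ℤ.+ k₂
  regCF-block = trans (regCF-cons (suc b) r) (cong (λ k → k ℤ.* k₁ ℤ.+ k₂) (ℤP.pos-+ 1 b))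

negCF-regToNegTail : ∀ r → Paired r →
  proj₁ (negCF (regToNegTail r)) ≡ + proj₁ (regCF r) ℤ.+ + proj₂ (regCF r)
  × proj₂ (negCF (regToNegTail r)) ≡ + proj₂ (regCF r)
negCF-regToNegTail []                [] = refl , refl
negCF-regToNegTail (a ∷ suc b ∷ r) (pair p) with negCF-regToNegTail r p
... | num≡ , den≡ = numerator , trans twos-numer (sym regCF-block)
  where
  open TwosBlock b r num≡ den≡
  open ≡-Reasoning
  M : ℤ
  M = (+ 1 ℤ.+ B) ℤ.* k₁ ℤ.+ k₂
  step : ∀ A B k₁ k₂ → (+ 2 ℤ.+ A) ℤ.* ((+ 1 ℤ.+ B) ℤ.* k₁ ℤ.+ k₂) ℤ.- (B ℤ.* k₁ ℤ.+ k₂)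
                       ≡ (A ℤ.* ((+ 1 ℤ.+ B) ℤ.* k₁ ℤ.+ k₂) ℤ.+ k₁) ℤ.+ ((+ 1 ℤ.+ B) ℤ.* k₁ ℤ.+ k₂)
  step = solveℤ
  numerator : + suc (suc a) ℤ.* proj₁ (negCF s) ℤ.- proj₂ (negCF s)
              ≡ + proj₁ (regCF (a ∷ suc b ∷ r)) ℤ.+ + proj₂ (regCF (a ∷ suc b ∷ r))
  numerator = begin
    + suc (suc a) ℤ.* proj₁ (negCF s) ℤ.- proj₂ (negCF s)
      ≡⟨ cong₂ (λ x y → x ℤ.* proj₁ (negCF s) ℤ.- y) (ℤP.pos-+ 2 a) twos-denom ⟩
    (+ 2 ℤ.+ + a) ℤ.* proj₁ (negCF s) ℤ.- (B ℤ.* k₁ ℤ.+ k₂)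
      ≡⟨ cong (λ x → (+ 2 ℤ.+ + a) ℤ.* x ℤ.- (B ℤ.* k₁ ℤ.+ k₂)) twos-numer ⟩
    (+ 2 ℤ.+ + a) ℤ.* M ℤ.- (B ℤ.* k₁ ℤ.+ k₂)
      ≡⟨ step (+ a) B k₁ k₂ ⟩
    (+ a ℤ.* M ℤ.+ k₁) ℤ.+ M
      ≡⟨ cong₂ (λ x y → (+ a ℤ.* x ℤ.+ k₁) ℤ.+ y) regCF-block regCF-block ⟨
    (+ a ℤ.* + proj₁ (regCF (suc b ∷ r)) ℤ.+ k₁) ℤ.+ + proj₁ (regCF (suc b ∷ r))
      ≡⟨ cong (ℤ._+ + proj₁ (regCF (suc b ∷ r))) (regCF-cons a (suc b ∷ r)) ⟨
    + proj₁ (regCF (a ∷ suc b ∷ r)) ℤ.+ + proj₂ (regCF (a ∷ suc b ∷ r)) ∎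

negCF-regToNeg : ∀ a b r → Paired (a ∷ b ∷ r) →
  proj₁ (negCF (regToNeg (a ∷ b ∷ r))) ≡ + proj₁ (regCF (a ∷ b ∷ r))
  × proj₂ (negCF (regToNeg (a ∷ b ∷ r))) ≡ + proj₂ (regCF (a ∷ b ∷ r))
negCF-regToNeg a (suc b) r (pair p) with negCF-regToNegTail r p
... | num≡ , den≡ = numerator , trans twos-numer (sym regCF-block)
  where
  open TwosBlock b r num≡ den≡
  open ≡-Reasoning
  M : ℤ
  M = (+ 1 ℤ.+ B) ℤ.* k₁ ℤ.+ k₂
  step : ∀ A B k₁ k₂ → (+ 1 ℤ.+ A) ℤ.* ((+ 1 ℤ.+ B) ℤ.* k₁ ℤ.+ k₂) ℤ.- (B ℤ.* k₁ ℤ.+ k₂)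
                       ≡ A ℤ.* ((+ 1 ℤ.+ B) ℤ.* k₁ ℤ.+ k₂) ℤ.+ k₁
  step = solveℤ
  numerator : + suc a ℤ.* proj₁ (negCF s) ℤ.- proj₂ (negCF s) ≡ + proj₁ (regCF (a ∷ suc b ∷ r))
  numerator = begin
    + suc a ℤ.* proj₁ (negCF s) ℤ.- proj₂ (negCF s)
      ≡⟨ cong₂ (λ x y → x ℤ.* proj₁ (negCF s) ℤ.- y) (ℤP.pos-+ 1 a) twos-denom ⟩
    (+ 1 ℤ.+ + a) ℤ.* proj₁ (negCF s) ℤ.- (B ℤ.* k₁ ℤ.+ k₂)
      ≡⟨ cong (λ x → (+ 1 ℤ.+ + a) ℤ.* x ℤ.- (B ℤ.* k₁ ℤ.+ k₂)) twos-numer ⟩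
    (+ 1 ℤ.+ + a) ℤ.* M ℤ.- (B ℤ.* k₁ ℤ.+ k₂)
      ≡⟨ step (+ a) B k₁ k₂ ⟩
    + a ℤ.* M ℤ.+ k₁
      ≡⟨ cong (λ x → + a ℤ.* x ℤ.+ k₁) regCF-block ⟨
    + a ℤ.* + proj₁ (regCF (suc b ∷ r)) ℤ.+ k₁
      ≡⟨ regCF-cons a (suc b ∷ r) ⟨
    + proj₁ (regCF (a ∷ suc b ∷ r)) ∎

data RegularExpansion : List ℕ → Set where
  regular : ∀ {a b r} → 1 ≤ a → Paired r → RegularExpansion (a ∷ suc b ∷ r)

paired : ∀ m as → length as ≡ 2 * m → All (1 ≤_) as → Paired as
paired m       []              _   _                   = []
paired zero    (a ∷ _)         ()  _
paired (suc m) (a ∷ [])        len _ with trans len (ℕP.+-suc (suc m) (m ℕ.+ 0))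
... | ()
paired (suc m) (a ∷ suc b ∷ r) len (_ ∷ _ ∷ r≥1) =
  pair (paired m r (ℕP.suc-injective (ℕP.suc-injective (trans len (ℕP.+-suc (suc m) (m ℕ.+ 0))))) r≥1)

regularExpansion : ∀ m → 1 ≤ m → ∀ as → length as ≡ 2 * m → All (1 ≤_) as → RegularExpansion as
regularExpansion (suc m) _ []        ()  _
regularExpansion (suc m) _ (a ∷ as′) len as≥1 with paired (suc m) (a ∷ as′) len as≥1 | as≥1
... | pair p | a≥1 ∷ _ = regular a≥1 p

twos-≥2 : ∀ n → All (2 ≤_) (twos n)
twos-≥2 n = All.replicate⁺ n (s≤s (s≤s z≤n))

regToNegTail-≥2 : ∀ r → All (2 ≤_) (regToNegTail r)
regToNegTail-≥2 (a ∷ b ∷ r) = s≤s (s≤s z≤n) ∷ All.++⁺ (twos-≥2 (b ∸ 1)) (regToNegTail-≥2 r)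
regToNegTail-≥2 []          = []
regToNegTail-≥2 (a ∷ [])    = []

regToNeg-≥2 : ∀ {as} → RegularExpansion as → All (2 ≤_) (regToNeg as)
regToNeg-≥2 {a ∷ b ∷ r} (regular a≥1 _) = s≤s a≥1 ∷ All.++⁺ (twos-≥2 (b ∸ 1)) (regToNegTail-≥2 r)

same-ratio : ∀ {r s p q p′ q′} → 0 < s → r * q ≡ p * s → r * q′ ≡ p′ * s → p * q′ ≡ p′ * q
same-ratio {r} {s} {p} {q} {p′} {q′} s>0 rq≡ps rq′≡p′s =
  ℕP.*-cancelˡ-≡ (p * q′) (p′ * q) s {{ℕ.>-nonZero s>0}} (begin
    s * (p * q′)   ≡⟨ swap s p q′ ⟩
    (p * s) * q′   ≡⟨ cong (_* q′) rq≡ps ⟨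
    (r * q) * q′   ≡⟨ swap q r q′ ⟨
    q * (r * q′)   ≡⟨ cong (q *_) rq′≡p′s ⟩
    q * (p′ * s)   ≡⟨ swap q p′ s ⟩
    (p′ * q) * s   ≡⟨ ℕP.*-comm (p′ * q) s ⟩
    s * (p′ * q)   ∎)
  where
  open ≡-Reasoning
  swap : ∀ x y z → x * (y * z) ≡ (y * x) * z
  swap = solveℕ

regToNeg-unique : ∀ {r s as cs} → 0 < s → RegularExpansion as → All (2 ≤_) cs →
  r * proj₂ (regCF as) ≡ proj₁ (regCF as) * s → + r ℤ.* proj₂ (negCF cs) ≡ proj₁ (negCF cs) ℤ.* + s →
  regToNeg as ≡ cs
regToNeg-unique {r} {s} {as@(a ∷ b ∷ rest)} {cs} s>0 reg@(regular _ p) cs≥2 regRatio negRatio =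
  negCFℕ-injective (regToNeg as) cs (regToNeg-≥2 reg) cs≥2
    (subst₂ (λ x y → x * proj₂ (negCFℕ cs) ≡ proj₁ (negCFℕ cs) * y) (sym num≡) (sym den≡)
      (same-ratio {r} {s} {proj₁ (regCF as)} {proj₂ (regCF as)} {proj₁ (negCFℕ cs)} {proj₂ (negCFℕ cs)}
                  s>0 regRatio negRatioℕ))
  where
  num≡ : proj₁ (negCFℕ (regToNeg as)) ≡ proj₁ (regCF as)
  num≡ = ℤP.+-injective (trans (sym (proj₁ (negCF≡negCFℕ (regToNeg as) (regToNeg-≥2 reg))))
                               (proj₁ (negCF-regToNeg a b rest (pair p))))
  den≡ : proj₂ (negCFℕ (regToNeg as)) ≡ proj₂ (regCF as)
  den≡ = ℤP.+-injective (trans (sym (proj₂ (negCF≡negCFℕ (regToNeg as) (regToNeg-≥2 reg))))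
                               (proj₂ (negCF-regToNeg a b rest (pair p))))
  negRatioℕ : r * proj₂ (negCFℕ cs) ≡ proj₁ (negCFℕ cs) * s
  negRatioℕ = ℤP.+-injective (begin
    + (r * proj₂ (negCFℕ cs))         ≡⟨ ℤP.pos-* r (proj₂ (negCFℕ cs)) ⟩
    + r ℤ.* + proj₂ (negCFℕ cs)       ≡⟨ cong (+ r ℤ.*_) (proj₂ (negCF≡negCFℕ cs cs≥2)) ⟨
    + r ℤ.* proj₂ (negCF cs)          ≡⟨ negRatio ⟩
    proj₁ (negCF cs) ℤ.* + s          ≡⟨ cong (ℤ._* + s) (proj₁ (negCF≡negCFℕ cs cs≥2)) ⟩
    + proj₁ (negCFℕ cs) ℤ.* + s       ≡⟨ ℤP.pos-* (proj₁ (negCFℕ cs)) s ⟨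
    + (proj₁ (negCFℕ cs) * s)         ∎)
    where open ≡-Reasoning

unit≡1 : ∀ {p r a b} → 0 < p → a ℤ.* b ≡ + 1 → + r ≡ + p ℤ.* a → a ≡ + 1
unit≡1 {a = + zero}          {b} _   ab≡1 _ = ⊥-elim (0≢1 (trans (sym (ℤP.*-zeroˡ b)) ab≡1))
  where
  0≢1 : + 0 ≢ + 1
  0≢1 ()
unit≡1 {a = + suc zero}          _   _    _ = refl
unit≡1 {a = + suc (suc n)}   {b} _   ab≡1 _
  with ℕP.m*n≡1⇒m≡1 (suc (suc n)) ℤ.∣ b ∣ (trans (sym (ℤP.abs-* (+ suc (suc n)) b)) (cong ℤ.∣_∣ ab≡1))
... | ()
unit≡1 {suc p} {r} { -[1+ n ]}   _   _    r≡pa = ⊥-elim (nonnegative r≡pa)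
  where
  nonnegative : ∀ {k} → + r ≢ -[1+ k ]
  nonnegative ()

eval1-qNumer : ∀ cs → All (2 ≤_) cs → eval1 (qNumer cs) ≡ + proj₁ (negCFℕ cs)
eval1-qNumer cs cs≥2 = trans (proj₁ (eval1-qCF cs)) (proj₁ (negCF≡negCFℕ cs cs≥2))

-- Evaluating R = N·a at q = 1 gives r = (numerator of r/s)·a, so the unit a is positive.
coprime⇒qCF : ∀ cs → All (2 ≤_) cs → ∀ {r} R S → CoprimeP R S → eval1 R ≡ + r →
  R *P qDenom cs ≈P S *P qNumer cs → R ≋ qNumer cs × S ≋ qDenom cs
coprime⇒qCF cs cs≥2 {r} R S coprime evalR RD≈SN = unitIsOne (coprime-qCF cs cs≥2 R S coprime RD≈SN)
  where
  unitIsOne : (Σ ℤ λ a → R ≋ qNumer cs *P (a ∷ []) × S ≋ qDenom cs *P (a ∷ []) × ∃ λ b → a ℤ.* b ≡ + 1) →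
    R ≋ qNumer cs × S ≋ qDenom cs
  unitIsOne (a , R≋Na , S≋Da , b , ab≡1) = ≋-trans R≋Na (cancel (qNumer cs)) , ≋-trans S≋Da (cancel (qDenom cs))
    where
    open ≡-Reasoning
    r≡pa : + r ≡ + proj₁ (negCFℕ cs) ℤ.* a
    r≡pa = begin
      + r                               ≡⟨ evalR ⟨
      eval1 R                           ≡⟨ eval1-cong R≋Na ⟩
      eval1 (qNumer cs *P (a ∷ []))     ≡⟨ eval1-*P (qNumer cs) (a ∷ []) ⟩
      eval1 (qNumer cs) ℤ.* (a ℤ.+ + 0) ≡⟨ cong₂ ℤ._*_ (eval1-qNumer cs cs≥2) (ℤP.+-identityʳ a) ⟩
      + proj₁ (negCFℕ cs) ℤ.* a         ∎
    cancel : ∀ P → P *P (a ∷ []) ≋ P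
    cancel P = subst (λ x → P *P (x ∷ []) ≋ P) (sym (unit≡1 (negCFℕ-num>0 cs cs≥2) ab≡1 r≡pa)) (*P-identityʳ P)

prefactor≃qpowL : ∀ a b r → prefactor (a ∷ suc b ∷ r) ≃ qpowL (evenSum (a ∷ suc b ∷ r) ∸ 1)
prefactor≃qpowL a b r = begin
  qpowL (suc e) *L q⁻¹       ≈⟨ *L-cong (qpowL-suc e) (≃-refl {q⁻¹}) ⟩
  (q *L qpowL e) *L q⁻¹      ≈⟨ regroup q (qpowL e) q⁻¹ ⟩
  qpowL e *L (q⁻¹ *L q)      ≈⟨ *L-cong (≃-refl {qpowL e}) (qinvPowL-inverse 1) ⟩
  qpowL e *L 1L              ≈⟨ *L-identityʳ (qpowL e) ⟩
  qpowL e                    ∎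
  where
  open ≃-Reasoning
  e : ℕ
  e = b ℕ.+ evenSum r
  regroup : ∀ x y z → (x *L y) *L z ≃ y *L (z *L x)
  regroup = solve-∀ laurentACR

qCF-regToNeg≃Kplus : ∀ a b r → Paired r →
  toL (qNumer (regToNeg (a ∷ suc b ∷ r))) ≃ qpowL (evenSum (a ∷ suc b ∷ r) ∸ 1) *L Kplus 0 (a ∷ suc b ∷ r)
  × toL (qDenom (regToNeg (a ∷ suc b ∷ r))) ≃ qpowL (evenSum (a ∷ suc b ∷ r) ∸ 1) *L Kplus 1 (suc b ∷ r)
qCF-regToNeg≃Kplus a b r p =
  ≃-trans (proj₁ (qCF-regToNeg a (suc b) r (pair p)))
          (*L-cong (prefactor≃qpowL a b r) (≃-sym (Kplus≃K⁺ 0 (a ∷ suc b ∷ r)))) ,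
  ≃-trans (proj₂ (qCF-regToNeg a (suc b) r (pair p)))
          (*L-cong (prefactor≃qpowL a b r) (≃-sym (Kplus≃K⁺ 1 (suc b ∷ r))))

qContinuants : ∀ a b rest {R S} → Paired rest →
  R ≋ qNumer (regToNeg (a ∷ suc b ∷ rest)) × S ≋ qDenom (regToNeg (a ∷ suc b ∷ rest)) →
  (R ≈P K (regToNeg (a ∷ suc b ∷ rest)))
  × (toL R ≈L qpowL (evenSum (a ∷ suc b ∷ rest) ∸ 1) *L Kplus 0 (a ∷ suc b ∷ rest))
  × (S ≈P K (drop1 (regToNeg (a ∷ suc b ∷ rest))))
  × (toL S ≈L qpowL (evenSum (a ∷ suc b ∷ rest) ∸ 1) *L Kplus 1 (suc b ∷ rest))
qContinuants a b rest p (R≋N , S≋D) =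
  coeff≡ (≋-trans R≋N (≋-sym (K≋qNumer cs))) ,
  ≃⇒≈L (≃-trans (toL-cong R≋N) (proj₁ (qCF-regToNeg≃Kplus a b rest p))) ,
  coeff≡ (≋-trans S≋D (≋-sym (K≋qNumer (drop1 cs)))) ,
  ≃⇒≈L (≃-trans (toL-cong S≋D) (proj₂ (qCF-regToNeg≃Kplus a b rest p)))
  where
  cs : List ℕ
  cs = regToNeg (a ∷ suc b ∷ rest)

proposition5p3 :
  (r s : ℕ) → 1 ≤ s → s < r → Coprime r s →
  (m : ℕ) → 1 ≤ m → (as : List ℕ) → Data.List.length as ≡ 2 * m → All (1 ≤_) as →
  r * proj₂ (regCF as) ≡ proj₁ (regCF as) * s →
  (cs : List ℕ) → cs ≢ [] → All (2 ≤_) cs →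
  (+ r) ℤ.* proj₂ (negCF cs) ≡ proj₁ (negCF cs) ℤ.* (+ s) →
  (R S : Poly) → CoprimeP R S → eval1 R ≡ + r → eval1 S ≡ + s →
  R *P proj₂ (qCF cs) ≈P S *P proj₁ (qCF cs) →
  (R ≈P K cs)
  × (toL R ≈L qpowL (evenSum as Data.Nat.∸ 1) *L Kplus 0 as)
  × (S ≈P K (drop1 cs))
  × (toL S ≈L qpowL (evenSum as Data.Nat.∸ 1) *L Kplus 1 (drop1 as))
proposition5p3 r s s≥1 _ _ m m≥1 as len as≥1 regRatio cs _ cs≥2 negRatio R S coprime evalR _ RD≈SN
  with regularExpansion m m≥1 as len as≥1
... | reg@(regular {a} {b} {rest} _ p) with regToNeg-unique {r} s≥1 reg cs≥2 regRatio negRatio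
... | refl = qContinuants a b rest p (coprime⇒qCF _ cs≥2 R S coprime evalR RD≈SN)
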